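{- For every integer $j\ge 0$, \[ F_{j+1}=\sum_{m=0}^{\left\lfloor j/2\right\rfloor}\frac{1}{c_{j-2m}}\binom{j-m}{j-2m}2^{ -j+2m+1}\;{}_{2}F_{1}\!\left(\begin{matrix}-m,\ j-m+1\\ j-2m+1\end{matrix}\,\Big|\,-\tfrac14\right) \] and \[ F_{j+1}=\frac{1}{2^j}\sum_{m=0}^{\left\lfloor j/2\right\rfloor}\binom{j}{m}\frac{(j-2m+1)^2}{j-m+1}\;{}_{2}F_{1}\!\left(\begin{matrix}-m,\ -j+m-1\\ -j\end{matrix}\,\Big|\,-4\right), \] where $c_0=2$ and $c_n=1$ for $n>0$.
   Context: $F_n$ denotes the $n$-th Fibonacci number ($F_0=0$, $F_1=1$, $F_{n+2}=F_{n+1}+F_n$). For a nonnegative integer $m$, ${}_2F_1\!\left(\begin{smallmatrix}-m,\ b\\ c\end{smallmatrix}\big|z\right)=\sum_{k=0}^{m}\frac{(-m)_k(b)_k}{(c)_k\,k!}z^k$, where $(a)_k=a(a+1)\cdots(a+k-1)$. -}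

module Defs where

open import Data.Nat as ℕ using (ℕ; zero; suc; ⌊_/2⌋; _!)
open import Data.Nat.Combinatorics using (_C_)
open import Data.Integer as ℤ using (ℤ; +_; -[1+_])
open import Data.Rational using (ℚ; 0ℚ; 1ℚ; _+_; _*_; _-_; -_; _÷_; _/_; ≢-nonZero)
open import Data.Rational.Properties using (_≟_)
open import Relation.Nullary using (yes; no)

fib : ℕ → ℕ
fib zero = zero
fib (suc zero) = suc zero
fib (suc (suc n)) = fib (suc n) ℕ.+ fib n

ℕtoℚ : ℕ → ℚ
ℕtoℚ n = (+ n) / 1

-- Division on ℚ, made total (x / 0 := 0). Only ever applied below to
-- nonzero denominators.
_//_ : ℚ → ℚ → ℚ
p // q with q ≟ 0ℚ
... | yes _ = 0ℚ
... | no q≢0 = _÷_ p q {{≢-nonZero q≢0}}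
infixl 7 _//_

_^ℚ_ : ℚ → ℕ → ℚ
q ^ℚ zero = 1ℚ
q ^ℚ suc n = (q ^ℚ n) * q
infixr 8 _^ℚ_

_^ℤ_ : ℚ → ℤ → ℚ
q ^ℤ (+ n) = q ^ℚ n
q ^ℤ -[1+ n ] = 1ℚ // (q ^ℚ suc n)

poch : ℚ → ℕ → ℚ
poch a zero = 1ℚ
poch a (suc k) = poch a k * (a + ℕtoℚ k)

sumTo : ℕ → (ℕ → ℚ) → ℚ
sumTo zero f = f zero
sumTo (suc m) f = sumTo m f + f (suc m)

-- terminating hypergeometric  2F1(-m, b; c | z) = Σ_{k=0}^{m} (-m)_k (b)_k / ((c)_k k!) z^k
hyp2F1 : ℕ → ℚ → ℚ → ℚ → ℚ
hyp2F1 m b c z =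
  sumTo m (λ k → ((poch (- ℕtoℚ m) k * poch b k) // (poch c k * ℕtoℚ (k !))) * z ^ℚ k)

cc : ℕ → ℚ
cc zero = ℕtoℚ 2
cc (suc n) = 1ℚ

rhs1 : ℕ → ℚ
rhs1 j = sumTo ⌊ j /2⌋ (λ m →
  (1ℚ // cc (j ℕ.∸ (2 ℕ.* m)))
  * ℕtoℚ ((j ℕ.∸ m) C (j ℕ.∸ (2 ℕ.* m)))
  * (ℕtoℚ 2 ^ℤ ((ℤ.- (+ j)) ℤ.+ (+ (2 ℕ.* m)) ℤ.+ (+ 1)))
  * hyp2F1 m (ℕtoℚ j - ℕtoℚ m + 1ℚ) (ℕtoℚ j - ℕtoℚ (2 ℕ.* m) + 1ℚ) (- (1ℚ // ℕtoℚ 4)))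

rhs2 : ℕ → ℚ
rhs2 j = (1ℚ // (ℕtoℚ 2 ^ℚ j)) * sumTo ⌊ j /2⌋ (λ m →
  ℕtoℚ (j C m)
  * ((ℕtoℚ j - ℕtoℚ (2 ℕ.* m) + 1ℚ) ^ℚ 2 // (ℕtoℚ j - ℕtoℚ m + 1ℚ))
  * hyp2F1 m (- ℕtoℚ j + ℕtoℚ m - 1ℚ) (- ℕtoℚ j) (- ℕtoℚ 4))

-- Writing every Pochhammer symbol as a ratio of factorials turns each term of the double sums
-- on the right into a product of binomial coefficients.  Over the triangle 0 ≤ k ≤ m ≤ ⌊j/2⌋,
-- the (m, k) term of the first sum is C(j-i, i) · C(N, r) · (2/c_{N-2r}) / 2^N with i = m - k,
-- r = k, N = j - 2i, and the (m, k) term of the sum in the second is C(j-k, k) · 4^k ·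
-- (N-2r+1)² C(N+1, r) / (N+1) with r = m - k, N = j - 2k.  Summing over r first, the inner sums are
--   Σ_{r ≤ N/2} C(N, r) · 2/c_{N-2r} = 2^N   (the row of Pascal's triangle folded at its middle),
--   Σ_{r ≤ N/2} (N-2r+1)² C(N+1, r) = (N+1) · 2^N,
-- and since 4^k · 2^{j-2k} = 2^j, both right-hand sides reduce to the diagonal sum of Pascal's
-- triangle Σ_{i ≤ j/2} C(j-i, i) = F_{j+1}.
module Submission where

open import Defs
open import Data.Nat using (ℕ; suc)
open import Data.Product using (_×_)
open import Relation.Binary.PropositionalEquality using (_≡_)

module Combinatorics where
  open import Data.Nat
  open import Data.Nat.Properties
  open import Data.Nat.Combinatorics
  open import Data.Nat.DivMod using (_/_; m/n*n≡m)
  open import Data.Nat.Tactic.RingSolver using (solve-∀)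
  open import Relation.Binary.PropositionalEquality
  open import Relation.Nullary using (yes; no)
  open ≡-Reasoning

  sumToℕ : ℕ → (ℕ → ℕ) → ℕ
  sumToℕ zero    f = f zero
  sumToℕ (suc m) f = sumToℕ m f + f (suc m)

  sumToℕ-cong : ∀ m {f g : ℕ → ℕ} → (∀ k → k ≤ m → f k ≡ g k) → sumToℕ m f ≡ sumToℕ m g
  sumToℕ-cong zero    f≗g = f≗g 0 z≤n
  sumToℕ-cong (suc m) f≗g =
    cong₂ _+_ (sumToℕ-cong m (λ k k≤m → f≗g k (m≤n⇒m≤1+n k≤m))) (f≗g (suc m) ≤-refl)

  sumToℕ-+ : ∀ m (f g : ℕ → ℕ) → sumToℕ m (λ k → f k + g k) ≡ sumToℕ m f + sumToℕ m g
  sumToℕ-+ zero    f g = refl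
  sumToℕ-+ (suc m) f g = begin
    sumToℕ m (λ k → f k + g k) + (f (suc m) + g (suc m))
      ≡⟨ cong (_+ (f (suc m) + g (suc m))) (sumToℕ-+ m f g) ⟩
    (sumToℕ m f + sumToℕ m g) + (f (suc m) + g (suc m))
      ≡⟨ +-interchange (sumToℕ m f) (sumToℕ m g) (f (suc m)) (g (suc m)) ⟩
    (sumToℕ m f + f (suc m)) + (sumToℕ m g + g (suc m)) ∎
    where
    +-interchange : ∀ a b c d → (a + b) + (c + d) ≡ (a + c) + (b + d)
    +-interchange = solve-∀

  sumToℕ-shift : ∀ m (f : ℕ → ℕ) → sumToℕ (suc m) f ≡ f 0 + sumToℕ m (λ k → f (suc k))
  sumToℕ-shift zero    f = refl
  sumToℕ-shift (suc m) f = trans (cong (_+ f (2+ m)) (sumToℕ-shift m f)) (+-assoc (f 0) _ _)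

  sumToℕ-vanishing-tail : ∀ m d (f : ℕ → ℕ) → (∀ k → m < k → f k ≡ 0) →
                          sumToℕ (m + d) f ≡ sumToℕ m f
  sumToℕ-vanishing-tail m zero    f tail rewrite +-identityʳ m = refl
  sumToℕ-vanishing-tail m (suc d) f tail rewrite +-suc m d =
    trans (cong₂ _+_ (sumToℕ-vanishing-tail m d f tail) (tail (suc (m + d)) (s≤s (m≤m+n m d))))
          (+-identityʳ _)

  binomial-factorials : ∀ a b → ((a + b) C a) * (a ! * b !) ≡ (a + b) !
  binomial-factorials a b = begin
    ((a + b) C a) * (a ! * b !)
      ≡⟨ cong (λ c → ((a + b) C a) * (a ! * c !)) (m+n∸m≡n a b) ⟨
    ((a + b) C a) * (a ! * (a + b ∸ a) !)
      ≡⟨ cong (_* (a ! * (a + b ∸ a) !)) (nCk≡n!/k![n-k]! (m≤m+n a b)) ⟩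
    (a + b) ! / (a ! * (a + b ∸ a) !) * (a ! * (a + b ∸ a) !)
      ≡⟨ m/n*n≡m (k![n∸k]!∣n! (m≤m+n a b)) ⟩
    (a + b) ! ∎
    where instance _ = a !* (a + b ∸ a) !≢0

  diagonalSum : ℕ → ℕ
  diagonalSum j = sumToℕ j (λ i → (j ∸ i) C i)

  private
    pascal-shifted : ∀ j i → i ≤ suc j → (suc j ∸ i) C suc i ≡ (j ∸ i) C i + (j ∸ i) C suc i
    pascal-shifted j i i≤1+j with i ≤? j
    ... | yes i≤j rewrite +-∸-assoc 1 i≤j = sym (nCk+nC[k+1]≡[n+1]C[k+1] (j ∸ i) i)
    ... | no  i≰j rewrite ≤-antisym i≤1+j (≰⇒> i≰j) | n∸n≡0 j | m≤n⇒m∸n≡0 (n≤1+n j) = refl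

    empty-row : ∀ j k → (j ∸ suc j) C suc k ≡ 0
    empty-row j k rewrite m≤n⇒m∸n≡0 (n≤1+n j) = refl

  diagonalSum-rec : ∀ j → diagonalSum (2+ j) ≡ diagonalSum (suc j) + diagonalSum j
  diagonalSum-rec j = begin
    diagonalSum (2+ j)
      ≡⟨ sumToℕ-shift (suc j) (λ i → (2+ j ∸ i) C i) ⟩
    1 + sumToℕ (suc j) (λ i → (suc j ∸ i) C suc i)
      ≡⟨ cong (1 +_) (sumToℕ-cong (suc j) (pascal-shifted j)) ⟩
    1 + sumToℕ (suc j) (λ i → (j ∸ i) C i + (j ∸ i) C suc i)
      ≡⟨ cong (1 +_) (sumToℕ-+ (suc j) _ _) ⟩
    1 + ((diagonalSum j + (j ∸ suc j) C suc j) + (S + (j ∸ suc j) C 2+ j))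
      ≡⟨ cong₂ (λ x y → 1 + ((diagonalSum j + x) + (S + y))) (empty-row j j) (empty-row j (suc j)) ⟩
    1 + ((diagonalSum j + 0) + (S + 0))
      ≡⟨ rearrange (diagonalSum j) S ⟩
    (1 + S) + diagonalSum j
      ≡⟨ cong (_+ diagonalSum j) (sumToℕ-shift j (λ i → (suc j ∸ i) C i)) ⟨
    diagonalSum (suc j) + diagonalSum j ∎
    where
    S = sumToℕ j (λ i → (j ∸ i) C suc i)
    rearrange : ∀ d s → 1 + ((d + 0) + (s + 0)) ≡ (1 + s) + d
    rearrange = solve-∀

  fib≡diagonalSum : ∀ j → fib (suc j) ≡ diagonalSum j
  fib≡diagonalSum zero          = refl
  fib≡diagonalSum (suc zero)    = refl
  fib≡diagonalSum (suc (suc j)) =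
    trans (cong₂ _+_ (fib≡diagonalSum (suc j)) (fib≡diagonalSum j)) (sym (diagonalSum-rec j))

  private
    <⌊/2⌋⇒<+ : ∀ j i → ⌊ j /2⌋ < i → j < i + i
    <⌊/2⌋⇒<+ zero          (suc i) _         = z<s
    <⌊/2⌋⇒<+ (suc zero)    (suc i) _         = s≤s (subst (1 ≤_) (sym (+-suc i i)) z<s)
    <⌊/2⌋⇒<+ (suc (suc j)) (suc i) (s≤s j<i) =
      s≤s (subst (suc j <_) (sym (+-suc i i)) (s≤s (<⌊/2⌋⇒<+ j i j<i)))

  fib≡sum-binomials : ∀ j → fib (suc j) ≡ sumToℕ ⌊ j /2⌋ (λ i → (j ∸ i) C i)
  fib≡sum-binomials j = begin
    fib (suc j)                                   ≡⟨ fib≡diagonalSum j ⟩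
    sumToℕ j row                                  ≡⟨ cong (λ n → sumToℕ n row) (⌊n/2⌋+⌈n/2⌉≡n j) ⟨
    sumToℕ (⌊ j /2⌋ + ⌈ j /2⌉) row                ≡⟨ sumToℕ-vanishing-tail ⌊ j /2⌋ ⌈ j /2⌉ row vanishes ⟩
    sumToℕ ⌊ j /2⌋ row                            ∎
    where
    row : ℕ → ℕ
    row i = (j ∸ i) C i
    vanishes : ∀ i → ⌊ j /2⌋ < i → row i ≡ 0
    vanishes i j/2<i with i ≤? j
    ... | yes i≤j = k>n⇒nCk≡0 (subst (j ∸ i <_) (m+n∸m≡n i i) (∸-monoˡ-< (<⌊/2⌋⇒<+ j i j/2<i) i≤j))
    ... | no  i≰j rewrite m≤n⇒m∸n≡0 (<⇒≤ (≰⇒> i≰j)) = k>n⇒nCk≡0 (≤-trans z<s (≰⇒> i≰j))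

  binomialPrefix : ℕ → ℕ → ℕ
  binomialPrefix N zero    = 0
  binomialPrefix N (suc R) = binomialPrefix N R + N C R

  binomialPrefix-pascal : ∀ N R →
    binomialPrefix (suc N) (suc R) ≡ binomialPrefix N (suc R) + binomialPrefix N R
  binomialPrefix-pascal N zero    = refl
  binomialPrefix-pascal N (suc R) = begin
    binomialPrefix (suc N) (suc R) + suc N C suc R
      ≡⟨ cong₂ _+_ (binomialPrefix-pascal N R) (sym (nCk+nC[k+1]≡[n+1]C[k+1] N R)) ⟩
    (binomialPrefix N (suc R) + binomialPrefix N R) + (N C R + N C suc R)
      ≡⟨ rearrange (binomialPrefix N (suc R)) (binomialPrefix N R) (N C R) (N C suc R) ⟩
    (binomialPrefix N (suc R) + N C suc R) + (binomialPrefix N R + N C R) ∎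
    where
    rearrange : ∀ a b c d → (a + b) + (c + d) ≡ (a + d) + (b + c)
    rearrange = solve-∀

  private
    middle-symmetry : ∀ a → suc (a + a) C suc a ≡ suc (a + a) C a
    middle-symmetry a =
      trans (nCk≡nC[n∸k] (s≤s (m≤m+n a a))) (cong (suc (a + a) C_) (m+n∸m≡n a a))

  mutual
    binomialPrefix-even : ∀ a → 2 * binomialPrefix (a + a) a + (a + a) C a ≡ 2 ^ (a + a)
    binomialPrefix-even zero    = refl
    binomialPrefix-even (suc a) rewrite +-suc a a = begin
      2 * binomialPrefix (suc n) (suc a) + suc n C suc a
        ≡⟨ cong₂ (λ x y → 2 * x + y) (binomialPrefix-pascal n a) (sym (nCk+nC[k+1]≡[n+1]C[k+1] n a)) ⟩
      2 * (binomialPrefix n (suc a) + binomialPrefix n a) + (n C a + n C suc a)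
        ≡⟨ cong (λ y → 2 * (binomialPrefix n a + n C a + binomialPrefix n a) + (n C a + y)) (middle-symmetry a) ⟩
      2 * (binomialPrefix n a + n C a + binomialPrefix n a) + (n C a + n C a)
        ≡⟨ collect (binomialPrefix n a) (n C a) ⟩
      4 * binomialPrefix n (suc a)
        ≡⟨ cong (4 *_) (binomialPrefix-odd a) ⟩
      4 * 2 ^ (a + a)
        ≡⟨ *-assoc 2 2 (2 ^ (a + a)) ⟩
      2 * (2 * 2 ^ (a + a)) ∎
      where
      n = suc (a + a)
      collect : ∀ y c → 2 * (y + c + y) + (c + c) ≡ 4 * (y + c)
      collect = solve-∀

    binomialPrefix-odd : ∀ a → binomialPrefix (suc (a + a)) (suc a) ≡ 2 ^ (a + a)
    binomialPrefix-odd a = begin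
      binomialPrefix (suc (a + a)) (suc a)
        ≡⟨ binomialPrefix-pascal (a + a) a ⟩
      binomialPrefix (a + a) a + (a + a) C a + binomialPrefix (a + a) a
        ≡⟨ collect (binomialPrefix (a + a) a) ((a + a) C a) ⟩
      2 * binomialPrefix (a + a) a + (a + a) C a
        ≡⟨ binomialPrefix-even a ⟩
      2 ^ (a + a) ∎
      where
      collect : ∀ y c → y + c + y ≡ 2 * y + c
      collect = solve-∀

  -- foldWeight n = 2 / c_n
  foldWeight : ℕ → ℕ
  foldWeight zero    = 1
  foldWeight (suc _) = 2

  data EvenOdd : ℕ → Set where
    even : ∀ a → EvenOdd (a + a)
    odd  : ∀ a → EvenOdd (suc (a + a))

  evenOdd : ∀ n → EvenOdd n
  evenOdd zero          = even 0
  evenOdd (suc zero)    = odd 0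
  evenOdd (suc (suc n)) with evenOdd n
  ... | even a = subst EvenOdd (+-suc (suc a) a) (even (suc a))
  ... | odd  a = subst EvenOdd (cong suc (+-suc (suc a) a)) (odd (suc a))

  ⌊[1+a+a]/2⌋≡a : ∀ a → ⌊ suc (a + a) /2⌋ ≡ a
  ⌊[1+a+a]/2⌋≡a zero    = refl
  ⌊[1+a+a]/2⌋≡a (suc a) rewrite +-suc a a = cong suc (⌊[1+a+a]/2⌋≡a a)

  2*n≡n+n : ∀ n → 2 * n ≡ n + n
  2*n≡n+n n = cong (n +_) (+-identityʳ n)

  2*⌊n/2⌋≤n : ∀ n → 2 * ⌊ n /2⌋ ≤ n
  2*⌊n/2⌋≤n n = subst₂ _≤_ (sym (2*n≡n+n ⌊ n /2⌋)) (⌊n/2⌋+⌈n/2⌉≡n n)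
                        (+-monoʳ-≤ ⌊ n /2⌋ (⌊n/2⌋≤⌈n/2⌉ n))

  ∸-2*-suc : ∀ N R → 2 * suc R ≤ N → N ∸ 2 * R ≡ 2 + (N ∸ 2 * suc R)
  ∸-2*-suc N R h = begin
    N ∸ 2 * R                    ≡⟨ cong (_∸ 2 * R) (m∸n+n≡m h) ⟨
    (e + 2 * suc R) ∸ 2 * R      ≡⟨ cong (_∸ 2 * R) (shift e R) ⟩
    (2 + e) + 2 * R ∸ 2 * R      ≡⟨ m+n∸n≡m (2 + e) (2 * R) ⟩
    2 + e                        ∎
    where
    e = N ∸ 2 * suc R
    shift : ∀ e r → e + 2 * suc r ≡ (2 + e) + 2 * r
    shift = solve-∀

  binomialPrefix-middle : ∀ N →
    2 * binomialPrefix N ⌊ N /2⌋ + (N C ⌊ N /2⌋) * foldWeight (N ∸ 2 * ⌊ N /2⌋) ≡ 2 ^ N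
  binomialPrefix-middle N with evenOdd N
  ... | even a rewrite sym (n≡⌊n+n/2⌋ a) | 2*n≡n+n a | n∸n≡0 (a + a) | *-identityʳ ((a + a) C a) =
    binomialPrefix-even a
  ... | odd a rewrite ⌊[1+a+a]/2⌋≡a a | 2*n≡n+n a | m+n∸n≡m 1 (a + a) = begin
    2 * S + (n C a) * 2   ≡⟨ collect S (n C a) ⟩
    2 * (S + n C a)       ≡⟨ cong (2 *_) (binomialPrefix-odd a) ⟩
    2 * 2 ^ (a + a)       ∎
    where
    n = suc (a + a)
    S = binomialPrefix n a
    collect : ∀ s c → 2 * s + c * 2 ≡ 2 * (s + c)
    collect = solve-∀

  folded-prefix : ∀ N R → 2 * R ≤ N →
    sumToℕ R (λ r → (N C r) * foldWeight (N ∸ 2 * r))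
      ≡ 2 * binomialPrefix N R + (N C R) * foldWeight (N ∸ 2 * R)
  folded-prefix N zero    _ = refl
  folded-prefix N (suc R) h = begin
    sumToℕ R f + f (suc R)
      ≡⟨ cong (_+ f (suc R)) (folded-prefix N R (≤-trans (*-monoʳ-≤ 2 (n≤1+n R)) h)) ⟩
    2 * binomialPrefix N R + (N C R) * foldWeight (N ∸ 2 * R) + f (suc R)
      ≡⟨ cong (λ x → 2 * binomialPrefix N R + (N C R) * foldWeight x + f (suc R)) (∸-2*-suc N R h) ⟩
    2 * binomialPrefix N R + (N C R) * 2 + f (suc R)
      ≡⟨ collect (binomialPrefix N R) (N C R) (f (suc R)) ⟩
    2 * (binomialPrefix N R + N C R) + f (suc R) ∎
    where
    f = λ r → (N C r) * foldWeight (N ∸ 2 * r)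
    collect : ∀ s c y → 2 * s + c * 2 + y ≡ 2 * (s + c) + y
    collect = solve-∀

  folded-binomial-sum : ∀ N → sumToℕ ⌊ N /2⌋ (λ r → (N C r) * foldWeight (N ∸ 2 * r)) ≡ 2 ^ N
  folded-binomial-sum N = trans (folded-prefix N ⌊ N /2⌋ (2*⌊n/2⌋≤n N)) (binomialPrefix-middle N)

  absorption : ∀ N R → suc R * (suc N C suc R) ≡ suc N * (N C R)
  absorption zero    zero    = refl
  absorption zero    (suc R) = *-zeroʳ (2+ R)
  absorption (suc N) zero    rewrite nC1≡n (2+ N) = *-comm 1 (2+ N)
  absorption (suc N) (suc R) = begin
    2+ R * (2+ N C 2+ R)
      ≡⟨ cong (2+ R *_) (nCk+nC[k+1]≡[n+1]C[k+1] (suc N) (suc R)) ⟨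
    2+ R * (suc N C suc R + suc N C 2+ R)
      ≡⟨ split (suc R) (suc N C suc R) (suc N C 2+ R) ⟩
    suc R * (suc N C suc R) + suc N C suc R + 2+ R * (suc N C 2+ R)
      ≡⟨ cong₂ (λ x y → x + suc N C suc R + y) (absorption N R) (absorption N (suc R)) ⟩
    suc N * (N C R) + suc N C suc R + suc N * (N C suc R)
      ≡⟨ cong (λ x → suc N * (N C R) + x + suc N * (N C suc R)) (nCk+nC[k+1]≡[n+1]C[k+1] N R) ⟨
    suc N * (N C R) + (N C R + N C suc R) + suc N * (N C suc R)
      ≡⟨ merge (suc N) (N C R) (N C suc R) ⟩
    2+ N * (N C R + N C suc R)
      ≡⟨ cong (2+ N *_) (nCk+nC[k+1]≡[n+1]C[k+1] N R) ⟩
    2+ N * (suc N C suc R) ∎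
    where
    split : ∀ r a b → suc r * (a + b) ≡ r * a + a + suc r * b
    split = solve-∀
    merge : ∀ n a b → n * a + (a + b) + n * b ≡ suc n * (a + b)
    merge = solve-∀

  absorption-below : ∀ N R → suc R * (N C suc R) + suc R * (N C R) ≡ suc N * (N C R)
  absorption-below N R = begin
    suc R * (N C suc R) + suc R * (N C R)   ≡⟨ *-distribˡ-+ (suc R) (N C suc R) (N C R) ⟨
    suc R * (N C suc R + N C R)             ≡⟨ cong (suc R *_) (+-comm (N C suc R) (N C R)) ⟩
    suc R * (N C R + N C suc R)             ≡⟨ cong (suc R *_) (nCk+nC[k+1]≡[n+1]C[k+1] N R) ⟩
    suc R * (suc N C suc R)                 ≡⟨ absorption N R ⟩
    suc N * (N C R)                         ∎

  -- The inductive step is checked after multiplying by R + 1, where the absorption identities apply.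
  weighted-prefix : ∀ N R → 2 * R ≤ N →
    sumToℕ R (λ r → (N ∸ 2 * r + 1) * (N ∸ 2 * r + 1) * (suc N C r))
      ≡ suc N * ((N ∸ 2 * R + 1) * (N C R) + 2 * binomialPrefix N R)
  weighted-prefix N zero    _ = expand N
    where
    expand : ∀ n → (n + 1) * (n + 1) * 1 ≡ suc n * ((n + 1) * 1 + 2 * 0)
    expand = solve-∀
  weighted-prefix N (suc R) h = *-cancelˡ-≡ _ _ (suc R) (begin
    suc R * (sumToℕ R f + f (suc R))
      ≡⟨ cong (λ x → suc R * (x + f (suc R))) (weighted-prefix N R (≤-trans (*-monoʳ-≤ 2 (n≤1+n R)) h)) ⟩
    suc R * (suc N * ((N ∸ 2 * R + 1) * X + 2 * S) + (e + 1) * (e + 1) * Z)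
      ≡⟨ cong (λ x → suc R * (suc N * ((x + 1) * X + 2 * S) + (e + 1) * (e + 1) * Z)) (∸-2*-suc N R h) ⟩
    suc R * (suc N * ((2 + e + 1) * X + 2 * S) + (e + 1) * (e + 1) * Z)
      ≡⟨ regroup R (suc N) e X S Z ⟩
    suc N * suc R * ((2 + e + 1) * X + 2 * S) + (e + 1) * (e + 1) * (suc R * Z)
      ≡⟨ cong (λ x → suc N * suc R * ((2 + e + 1) * X + 2 * S) + (e + 1) * (e + 1) * x) (absorption N R) ⟩
    suc N * suc R * ((2 + e + 1) * X + 2 * S) + (e + 1) * (e + 1) * (suc N * X)
      ≡⟨ regroup′ R (suc N) e X S ⟩
    suc N * ((e + 1) * ((R + 2 + e) * X) + 2 * suc R * (S + X))
      ≡⟨ cong (λ x → suc N * ((e + 1) * x + 2 * suc R * (S + X))) next-binomial ⟨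
    suc N * ((e + 1) * (suc R * Y) + 2 * suc R * (S + X))
      ≡⟨ regroup″ R (suc N) e X S Y ⟩
    suc R * (suc N * ((e + 1) * Y + 2 * (S + X))) ∎)
    where
    f = λ r → (N ∸ 2 * r + 1) * (N ∸ 2 * r + 1) * (suc N C r)
    e = N ∸ 2 * suc R
    X = N C R
    Y = N C suc R
    Z = suc N C suc R
    S = binomialPrefix N R
    regroup : ∀ r n e x s z → suc r * (n * ((2 + e + 1) * x + 2 * s) + (e + 1) * (e + 1) * z)
                            ≡ n * suc r * ((2 + e + 1) * x + 2 * s) + (e + 1) * (e + 1) * (suc r * z)
    regroup = solve-∀
    regroup′ : ∀ r n e x s → n * suc r * ((2 + e + 1) * x + 2 * s) + (e + 1) * (e + 1) * (n * x)
                           ≡ n * ((e + 1) * ((r + 2 + e) * x) + 2 * suc r * (s + x))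
    regroup′ = solve-∀
    regroup″ : ∀ r n e x s y → n * ((e + 1) * (suc r * y) + 2 * suc r * (s + x))
                             ≡ suc r * (n * ((e + 1) * y + 2 * (s + x)))
    regroup″ = solve-∀
    split : ∀ e r x → suc (e + 2 * suc r) * x ≡ (r + 2 + e) * x + suc r * x
    split = solve-∀
    next-binomial : suc R * Y ≡ (R + 2 + e) * X
    next-binomial = +-cancelʳ-≡ (suc R * X) _ _ (begin
      suc R * Y + suc R * X          ≡⟨ absorption-below N R ⟩
      suc N * X                      ≡⟨ cong (λ n → suc n * X) (m∸n+n≡m h) ⟨
      suc (e + 2 * suc R) * X        ≡⟨ split e R X ⟩
      (R + 2 + e) * X + suc R * X    ∎)

  weighted-binomial-sum : ∀ N →
    sumToℕ ⌊ N /2⌋ (λ r → (N ∸ 2 * r + 1) * (N ∸ 2 * r + 1) * (suc N C r)) ≡ suc N * 2 ^ N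
  weighted-binomial-sum N = begin
    sumToℕ R (λ r → (N ∸ 2 * r + 1) * (N ∸ 2 * r + 1) * (suc N C r))
      ≡⟨ weighted-prefix N R (2*⌊n/2⌋≤n N) ⟩
    suc N * ((N ∸ 2 * R + 1) * (N C R) + 2 * binomialPrefix N R)
      ≡⟨ cong (λ x → suc N * (x * (N C R) + 2 * binomialPrefix N R)) (middle-weight N) ⟨
    suc N * (foldWeight (N ∸ 2 * R) * (N C R) + 2 * binomialPrefix N R)
      ≡⟨ cong (suc N *_) (swap (foldWeight (N ∸ 2 * R)) (N C R) (binomialPrefix N R)) ⟩
    suc N * (2 * binomialPrefix N R + (N C R) * foldWeight (N ∸ 2 * R))
      ≡⟨ cong (suc N *_) (binomialPrefix-middle N) ⟩
    suc N * 2 ^ N ∎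
    where
    R = ⌊ N /2⌋
    swap : ∀ w c s → w * c + 2 * s ≡ 2 * s + c * w
    swap = solve-∀
    middle-weight : ∀ N → foldWeight (N ∸ 2 * ⌊ N /2⌋) ≡ N ∸ 2 * ⌊ N /2⌋ + 1
    middle-weight N with evenOdd N
    ... | even a rewrite sym (n≡⌊n+n/2⌋ a) | 2*n≡n+n a | n∸n≡0 (a + a) = refl
    ... | odd  a rewrite ⌊[1+a+a]/2⌋≡a a | 2*n≡n+n a | m+n∸n≡m 1 (a + a) = refl

  ⌊[n∸2*i]/2⌋≡⌊n/2⌋∸i : ∀ n i → ⌊ n ∸ 2 * i /2⌋ ≡ ⌊ n /2⌋ ∸ i
  ⌊[n∸2*i]/2⌋≡⌊n/2⌋∸i n             zero    = refl
  ⌊[n∸2*i]/2⌋≡⌊n/2⌋∸i zero          (suc i) = refl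
  ⌊[n∸2*i]/2⌋≡⌊n/2⌋∸i (suc zero)    (suc i) = cong ⌊_/2⌋ (0∸n≡0 (i + suc (i + 0)))
  ⌊[n∸2*i]/2⌋≡⌊n/2⌋∸i (suc (suc n)) (suc i) =
    trans (cong (λ k → ⌊ suc n ∸ k /2⌋) (+-suc i (i + 0))) (⌊[n∸2*i]/2⌋≡⌊n/2⌋∸i n i)

  ≤⌊n/2⌋⇒2*≤n : ∀ {n i} → i ≤ ⌊ n /2⌋ → 2 * i ≤ n
  ≤⌊n/2⌋⇒2*≤n {n} i≤ = ≤-trans (*-monoʳ-≤ 2 i≤) (2*⌊n/2⌋≤n n)

  m≡n+o⇒m∸n≡o : ∀ {m} n o → m ≡ n + o → m ∸ n ≡ o
  m≡n+o⇒m∸n≡o n o m≡n+o = trans (cong (_∸ n) m≡n+o) (m+n∸m≡n n o)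

  m≡n+o⇒n≤m : ∀ {m} n o → m ≡ n + o → n ≤ m
  m≡n+o⇒n≤m n o m≡n+o = subst (n ≤_) (sym m≡n+o) (m≤m+n n o)

  2*m+n∸m≡n+m : ∀ m n → 2 * m + n ∸ m ≡ n + m
  2*m+n∸m≡n+m m n = m≡n+o⇒m∸n≡o m (n + m) (split m n)
    where
    split : ∀ m n → 2 * m + n ≡ m + (n + m)
    split = solve-∀

  2^[n+2r]≡2^n*4^r : ∀ n r → 2 ^ (n + 2 * r) ≡ 2 ^ n * 4 ^ r
  2^[n+2r]≡2^n*4^r n r = trans (^-distribˡ-+-* 2 n (2 * r)) (cong (2 ^ n *_) (sym (^-*-assoc 2 2 r)))

open import Data.Nat as ℕ using (zero; _∸_; _≤_; _!; ⌊_/2⌋)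
import Data.Nat.Properties as ℕₚ
open import Data.Nat.Combinatorics using (_C_)
open import Data.Integer as ℤ using (+_)
import Data.Integer.Properties as ℤₚ
open import Data.Rational as ℚ using (ℚ; 0ℚ; 1ℚ; _+_; _*_; _-_; -_; toℚᵘ; ≢-nonZero)
import Data.Rational.Properties as ℚₚ
import Data.Rational.Unnormalised as ℚᵘ
import Data.Rational.Unnormalised.Properties as ℚᵘₚ
open import Data.Empty using (⊥-elim)
open import Data.Sum using (_⊎_; inj₁; inj₂)
open import Data.Product using (_,_)
open import Relation.Nullary using (yes; no; dec⇒maybe)
open import Relation.Binary.PropositionalEquality
  using (refl; sym; trans; cong; cong₂; subst; _≢_; module ≡-Reasoning)
open import Tactic.RingSolver using (solve-∀)
open import Data.Nat.Tactic.RingSolver using () renaming (solve-∀ to ℕ-solve-∀; solve to ℕ-solve)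
open import Data.Integer.Tactic.RingSolver using () renaming (solve-∀ to ℤ-solve-∀)
open import Data.List.Base using (_∷_; [])
open import Tactic.RingSolver.Core.AlmostCommutativeRing
  using (AlmostCommutativeRing; fromCommutativeRing)

open Combinatorics

-- Rational arithmetic

ℚ-ring : AlmostCommutativeRing _ _
ℚ-ring = fromCommutativeRing ℚₚ.+-*-commutativeRing (λ x → dec⇒maybe (0ℚ ℚₚ.≟ x))

⟦_⟧ : ℕ → ℚ
⟦_⟧ = ℕtoℚ

private
  toℚᵘ-ℕtoℚ : ∀ n → toℚᵘ ⟦ n ⟧ ℚᵘ.≃ ℚᵘ.mkℚᵘ (+ n) 0
  toℚᵘ-ℕtoℚ n = ℚₚ.toℚᵘ-fromℚᵘ (ℚᵘ.mkℚᵘ (+ n) 0)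

ℕtoℚ-homo-+ : ∀ m n → ⟦ m ℕ.+ n ⟧ ≡ ⟦ m ⟧ + ⟦ n ⟧
ℕtoℚ-homo-+ m n = ℚₚ.toℚᵘ-injective (begin
  toℚᵘ ⟦ m ℕ.+ n ⟧                               ≈⟨ toℚᵘ-ℕtoℚ (m ℕ.+ n) ⟩
  ℚᵘ.mkℚᵘ (+ (m ℕ.+ n)) 0                        ≈⟨ ℚᵘ.*≡* (cong (ℤ._* + 1) (trans (ℤₚ.pos-+ m n) (unit (+ m) (+ n)))) ⟩
  ℚᵘ.mkℚᵘ (+ m) 0 ℚᵘ.+ ℚᵘ.mkℚᵘ (+ n) 0           ≈⟨ ℚᵘₚ.+-cong (toℚᵘ-ℕtoℚ m) (toℚᵘ-ℕtoℚ n) ⟨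
  toℚᵘ ⟦ m ⟧ ℚᵘ.+ toℚᵘ ⟦ n ⟧                      ≈⟨ ℚₚ.toℚᵘ-homo-+ ⟦ m ⟧ ⟦ n ⟧ ⟨
  toℚᵘ (⟦ m ⟧ + ⟦ n ⟧)                           ∎)
  where
  open ℚᵘₚ.≃-Reasoning
  unit : ∀ (a b : ℤ.ℤ) → a ℤ.+ b ≡ a ℤ.* + 1 ℤ.+ b ℤ.* + 1
  unit a b = sym (cong₂ ℤ._+_ (ℤₚ.*-identityʳ a) (ℤₚ.*-identityʳ b))

ℕtoℚ-homo-* : ∀ m n → ⟦ m ℕ.* n ⟧ ≡ ⟦ m ⟧ * ⟦ n ⟧
ℕtoℚ-homo-* m n = ℚₚ.toℚᵘ-injective (begin
  toℚᵘ ⟦ m ℕ.* n ⟧                               ≈⟨ toℚᵘ-ℕtoℚ (m ℕ.* n) ⟩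
  ℚᵘ.mkℚᵘ (+ (m ℕ.* n)) 0                        ≈⟨ ℚᵘ.*≡* (cong (ℤ._* + 1) (ℤₚ.pos-* m n)) ⟩
  ℚᵘ.mkℚᵘ (+ m) 0 ℚᵘ.* ℚᵘ.mkℚᵘ (+ n) 0           ≈⟨ ℚᵘₚ.*-cong (toℚᵘ-ℕtoℚ m) (toℚᵘ-ℕtoℚ n) ⟨
  toℚᵘ ⟦ m ⟧ ℚᵘ.* toℚᵘ ⟦ n ⟧                      ≈⟨ ℚₚ.toℚᵘ-homo-* ⟦ m ⟧ ⟦ n ⟧ ⟨
  toℚᵘ (⟦ m ⟧ * ⟦ n ⟧)                           ∎)
  where open ℚᵘₚ.≃-Reasoning

ℕtoℚ-injective : ∀ {m n} → ⟦ m ⟧ ≡ ⟦ n ⟧ → m ≡ n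
ℕtoℚ-injective {m} {n} eq
  with ℚᵘₚ.≃-trans (ℚᵘₚ.≃-sym (toℚᵘ-ℕtoℚ m)) (ℚᵘₚ.≃-trans (ℚₚ.toℚᵘ-cong eq) (toℚᵘ-ℕtoℚ n))
... | ℚᵘ.*≡* m*1≡n*1 =
  ℤₚ.+-injective (trans (sym (ℤₚ.*-identityʳ (+ m))) (trans m*1≡n*1 (ℤₚ.*-identityʳ (+ n))))

ℕtoℚ-≢0 : ∀ n .{{_ : ℕ.NonZero n}} → ⟦ n ⟧ ≢ 0ℚ
ℕtoℚ-≢0 (suc n) eq = ℕₚ.1+n≢0 (ℕtoℚ-injective {suc n} {0} eq)

ℕtoℚ-suc : ∀ x → ⟦ suc x ⟧ ≡ ⟦ x ⟧ + 1ℚ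
ℕtoℚ-suc x = trans (cong ⟦_⟧ (ℕₚ.+-comm 1 x)) (ℕtoℚ-homo-+ x 1)

ℕtoℚ-∸ : ∀ {m n} → n ≤ m → ⟦ m ∸ n ⟧ ≡ ⟦ m ⟧ - ⟦ n ⟧
ℕtoℚ-∸ {m} {n} n≤m = begin
  ⟦ m ∸ n ⟧                           ≡⟨ cancel ⟦ m ∸ n ⟧ ⟦ n ⟧ ⟨
  ⟦ m ∸ n ⟧ + ⟦ n ⟧ - ⟦ n ⟧           ≡⟨ cong (_- ⟦ n ⟧) (ℕtoℚ-homo-+ (m ∸ n) n) ⟨
  ⟦ m ∸ n ℕ.+ n ⟧ - ⟦ n ⟧             ≡⟨ cong (λ x → ⟦ x ⟧ - ⟦ n ⟧) (ℕₚ.m∸n+n≡m n≤m) ⟩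
  ⟦ m ⟧ - ⟦ n ⟧                       ∎
  where
  open ≡-Reasoning
  cancel : ∀ x y → x + y - y ≡ x
  cancel = solve-∀ ℚ-ring

ℕtoℚ-homo-^ : ∀ a k → ⟦ a ⟧ ^ℚ k ≡ ⟦ a ℕ.^ k ⟧
ℕtoℚ-homo-^ a zero    = refl
ℕtoℚ-homo-^ a (suc k) = begin
  ⟦ a ⟧ ^ℚ k * ⟦ a ⟧         ≡⟨ cong (_* ⟦ a ⟧) (ℕtoℚ-homo-^ a k) ⟩
  ⟦ a ℕ.^ k ⟧ * ⟦ a ⟧        ≡⟨ ℚₚ.*-comm ⟦ a ℕ.^ k ⟧ ⟦ a ⟧ ⟩
  ⟦ a ⟧ * ⟦ a ℕ.^ k ⟧        ≡⟨ ℕtoℚ-homo-* a (a ℕ.^ k) ⟨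
  ⟦ a ℕ.* a ℕ.^ k ⟧          ∎
  where open ≡-Reasoning

*-interchange : ∀ a b c d → a * b * (c * d) ≡ a * c * (b * d)
*-interchange = solve-∀ ℚ-ring

-- inv 0ℚ = 0ℚ, so inv is multiplicative without side conditions.
inv : ℚ → ℚ
inv q = 1ℚ // q

//-inv : ∀ p q → p // q ≡ p * inv q
//-inv p q with q ℚₚ.≟ 0ℚ
... | yes _ = sym (ℚₚ.*-zeroʳ p)
... | no  _ = cong (p *_) (sym (ℚₚ.*-identityˡ _))

*-inverseʳ : ∀ q → q ≢ 0ℚ → q * inv q ≡ 1ℚ
*-inverseʳ q q≢0 with q ℚₚ.≟ 0ℚ
... | yes q≡0 = ⊥-elim (q≢0 q≡0)
... | no  _   = trans (cong (q *_) (ℚₚ.*-identityˡ _)) (ℚₚ.*-inverseʳ q {{≢-nonZero q≢0}})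

inv-unique : ∀ q r → q * r ≡ 1ℚ → inv q ≡ r
inv-unique q r qr≡1 = begin
  inv q              ≡⟨ ℚₚ.*-identityʳ (inv q) ⟨
  inv q * 1ℚ         ≡⟨ cong (inv q *_) qr≡1 ⟨
  inv q * (q * r)    ≡⟨ ℚₚ.*-assoc (inv q) q r ⟨
  inv q * q * r      ≡⟨ cong (_* r) (trans (ℚₚ.*-comm (inv q) q) (*-inverseʳ q q≢0)) ⟩
  1ℚ * r             ≡⟨ ℚₚ.*-identityˡ r ⟩
  r                  ∎
  where
  open ≡-Reasoning
  q≢0 : q ≢ 0ℚ
  q≢0 refl = ℚₚ.1≢0 (trans (sym qr≡1) (ℚₚ.*-zeroˡ r))

-- Splitting on this rather than on q ≟ 0ℚ keeps `with` from abstracting the test inside inv q.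
private
  ≡0⊎≢0 : ∀ q → q ≡ 0ℚ ⊎ q ≢ 0ℚ
  ≡0⊎≢0 q with q ℚₚ.≟ 0ℚ
  ... | yes q≡0 = inj₁ q≡0
  ... | no  q≢0 = inj₂ q≢0

inv-* : ∀ p q → inv (p * q) ≡ inv p * inv q
inv-* p q with ≡0⊎≢0 p | ≡0⊎≢0 q
... | inj₁ refl | _        = trans (cong inv (ℚₚ.*-zeroˡ q)) (sym (ℚₚ.*-zeroˡ (inv q)))
... | inj₂ _    | inj₁ refl = trans (cong inv (ℚₚ.*-zeroʳ p)) (sym (ℚₚ.*-zeroʳ (inv p)))
... | inj₂ p≢0  | inj₂ q≢0  = inv-unique (p * q) (inv p * inv q) (begin
  p * q * (inv p * inv q)      ≡⟨ *-interchange p q (inv p) (inv q) ⟩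
  p * inv p * (q * inv q)      ≡⟨ cong₂ _*_ (*-inverseʳ p p≢0) (*-inverseʳ q q≢0) ⟩
  1ℚ                           ∎)
  where open ≡-Reasoning

inv-involutive : ∀ q → inv (inv q) ≡ q
inv-involutive q with ≡0⊎≢0 q
... | inj₁ refl = refl
... | inj₂ q≢0  = inv-unique (inv q) q (trans (ℚₚ.*-comm (inv q) q) (*-inverseʳ q q≢0))

inv-^ : ∀ x k → inv x ^ℚ k ≡ inv (x ^ℚ k)
inv-^ x zero    = refl
inv-^ x (suc k) = trans (cong (_* inv x) (inv-^ x k)) (sym (inv-* (x ^ℚ k) x))

infixl 3 _⊛_
_⊛_ : ∀ {m n} → ℕ.NonZero m → ℕ.NonZero n → ℕ.NonZero (m ℕ.* n)
_⊛_ {m} {n} m≢0 n≢0 = ℕₚ.m*n≢0 m n {{m≢0}} {{n≢0}}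

frac : ℕ → ℕ → ℚ
frac a b = ⟦ a ⟧ * inv ⟦ b ⟧

frac-* : ∀ a b c d → frac a b * frac c d ≡ frac (a ℕ.* c) (b ℕ.* d)
frac-* a b c d = begin
  ⟦ a ⟧ * inv ⟦ b ⟧ * (⟦ c ⟧ * inv ⟦ d ⟧)      ≡⟨ *-interchange ⟦ a ⟧ (inv ⟦ b ⟧) ⟦ c ⟧ (inv ⟦ d ⟧) ⟩
  ⟦ a ⟧ * ⟦ c ⟧ * (inv ⟦ b ⟧ * inv ⟦ d ⟧)      ≡⟨ cong₂ _*_ (ℕtoℚ-homo-* a c) (inv-* ⟦ b ⟧ ⟦ d ⟧) ⟨
  ⟦ a ℕ.* c ⟧ * inv (⟦ b ⟧ * ⟦ d ⟧)            ≡⟨ cong (λ x → ⟦ a ℕ.* c ⟧ * inv x) (ℕtoℚ-homo-* b d) ⟨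
  ⟦ a ℕ.* c ⟧ * inv ⟦ b ℕ.* d ⟧                ∎
  where open ≡-Reasoning

frac-inv : ∀ a b → inv (frac a b) ≡ frac b a
frac-inv a b = begin
  inv (⟦ a ⟧ * inv ⟦ b ⟧)          ≡⟨ inv-* ⟦ a ⟧ (inv ⟦ b ⟧) ⟩
  inv ⟦ a ⟧ * inv (inv ⟦ b ⟧)      ≡⟨ cong (inv ⟦ a ⟧ *_) (inv-involutive ⟦ b ⟧) ⟩
  inv ⟦ a ⟧ * ⟦ b ⟧                ≡⟨ ℚₚ.*-comm (inv ⟦ a ⟧) ⟦ b ⟧ ⟩
  ⟦ b ⟧ * inv ⟦ a ⟧                ∎
  where open ≡-Reasoning

frac-1 : ∀ a → frac a 1 ≡ ⟦ a ⟧
frac-1 a = ℚₚ.*-identityʳ ⟦ a ⟧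

frac-cross : ∀ a b c d .{{_ : ℕ.NonZero b}} .{{_ : ℕ.NonZero d}} →
             a ℕ.* d ≡ c ℕ.* b → frac a b ≡ frac c d
frac-cross a b c d ad≡cb = begin
  ⟦ a ⟧ * inv ⟦ b ⟧                              ≡⟨ ℚₚ.*-identityʳ _ ⟨
  ⟦ a ⟧ * inv ⟦ b ⟧ * 1ℚ                         ≡⟨ cong (⟦ a ⟧ * inv ⟦ b ⟧ *_) d/d ⟨
  ⟦ a ⟧ * inv ⟦ b ⟧ * (⟦ d ⟧ * inv ⟦ d ⟧)        ≡⟨ *-interchange ⟦ a ⟧ (inv ⟦ b ⟧) ⟦ d ⟧ (inv ⟦ d ⟧) ⟩
  ⟦ a ⟧ * ⟦ d ⟧ * (inv ⟦ b ⟧ * inv ⟦ d ⟧)        ≡⟨ cong (_* (inv ⟦ b ⟧ * inv ⟦ d ⟧)) lift ⟩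
  ⟦ c ⟧ * ⟦ b ⟧ * (inv ⟦ b ⟧ * inv ⟦ d ⟧)        ≡⟨ regroup ⟦ c ⟧ ⟦ b ⟧ (inv ⟦ b ⟧) (inv ⟦ d ⟧) ⟩
  ⟦ c ⟧ * inv ⟦ d ⟧ * (⟦ b ⟧ * inv ⟦ b ⟧)        ≡⟨ cong (⟦ c ⟧ * inv ⟦ d ⟧ *_) b/b ⟩
  ⟦ c ⟧ * inv ⟦ d ⟧ * 1ℚ                         ≡⟨ ℚₚ.*-identityʳ _ ⟩
  ⟦ c ⟧ * inv ⟦ d ⟧                              ∎
  where
  open ≡-Reasoning
  b/b = *-inverseʳ ⟦ b ⟧ (ℕtoℚ-≢0 b)
  d/d = *-inverseʳ ⟦ d ⟧ (ℕtoℚ-≢0 d)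
  lift : ⟦ a ⟧ * ⟦ d ⟧ ≡ ⟦ c ⟧ * ⟦ b ⟧
  lift = trans (sym (ℕtoℚ-homo-* a d)) (trans (cong ⟦_⟧ ad≡cb) (ℕtoℚ-homo-* c b))
  regroup : ∀ c b b′ d′ → c * b * (b′ * d′) ≡ c * d′ * (b * b′)
  regroup = solve-∀ ℚ-ring

frac-*-denominator : ∀ a b .{{_ : ℕ.NonZero b}} → frac a b * ⟦ b ⟧ ≡ ⟦ a ⟧
frac-*-denominator a b = begin
  ⟦ a ⟧ * inv ⟦ b ⟧ * ⟦ b ⟧       ≡⟨ ℚₚ.*-assoc ⟦ a ⟧ (inv ⟦ b ⟧) ⟦ b ⟧ ⟩
  ⟦ a ⟧ * (inv ⟦ b ⟧ * ⟦ b ⟧)     ≡⟨ cong (⟦ a ⟧ *_) (trans (ℚₚ.*-comm (inv ⟦ b ⟧) ⟦ b ⟧) b/b) ⟩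
  ⟦ a ⟧ * 1ℚ                      ≡⟨ ℚₚ.*-identityʳ ⟦ a ⟧ ⟩
  ⟦ a ⟧                           ∎
  where
  open ≡-Reasoning
  b/b = *-inverseʳ ⟦ b ⟧ (ℕtoℚ-≢0 b)

frac-cancel : ∀ a b .{{_ : ℕ.NonZero b}} → frac (a ℕ.* b) b ≡ ⟦ a ⟧
frac-cancel a b = trans (frac-cross (a ℕ.* b) b a 1 (ℕₚ.*-identityʳ (a ℕ.* b))) (frac-1 a)

frac-*-multiple : ∀ a b c .{{_ : ℕ.NonZero b}} → frac a b * ⟦ b ℕ.* c ⟧ ≡ ⟦ a ℕ.* c ⟧
frac-*-multiple a b c = begin
  frac a b * ⟦ b ℕ.* c ⟧          ≡⟨ cong (frac a b *_) (ℕtoℚ-homo-* b c) ⟩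
  frac a b * (⟦ b ⟧ * ⟦ c ⟧)      ≡⟨ ℚₚ.*-assoc (frac a b) ⟦ b ⟧ ⟦ c ⟧ ⟨
  frac a b * ⟦ b ⟧ * ⟦ c ⟧        ≡⟨ cong (_* ⟦ c ⟧) (frac-*-denominator a b) ⟩
  ⟦ a ⟧ * ⟦ c ⟧                   ≡⟨ ℕtoℚ-homo-* a c ⟨
  ⟦ a ℕ.* c ⟧                     ∎
  where open ≡-Reasoning

divide-⟦⟧ : ∀ x y b .{{_ : ℕ.NonZero b}} → x * ⟦ b ⟧ ≡ y → x ≡ y * inv ⟦ b ⟧
divide-⟦⟧ x y b xb≡y = begin
  x                           ≡⟨ ℚₚ.*-identityʳ x ⟨
  x * 1ℚ                      ≡⟨ cong (x *_) (*-inverseʳ ⟦ b ⟧ (ℕtoℚ-≢0 b)) ⟨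
  x * (⟦ b ⟧ * inv ⟦ b ⟧)     ≡⟨ ℚₚ.*-assoc x ⟦ b ⟧ (inv ⟦ b ⟧) ⟨
  x * ⟦ b ⟧ * inv ⟦ b ⟧       ≡⟨ cong (_* inv ⟦ b ⟧) xb≡y ⟩
  y * inv ⟦ b ⟧               ∎
  where open ≡-Reasoning

ℕtoℚ-C : ∀ {n} a b → n ≡ a ℕ.+ b → ⟦ n C a ⟧ ≡ frac (n !) (a ! ℕ.* b !)
ℕtoℚ-C a b refl = divide-⟦⟧ ⟦ (a ℕ.+ b) C a ⟧ ⟦ (a ℕ.+ b) ! ⟧ (a ! ℕ.* b !) {{a ℕₚ.!* b !≢0}}
  (trans (sym (ℕtoℚ-homo-* ((a ℕ.+ b) C a) (a ! ℕ.* b !))) (cong ⟦_⟧ (binomial-factorials a b)))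

sign : ℕ → ℚ
sign k = (- 1ℚ) ^ℚ k

sign-square : ∀ k → sign k * sign k ≡ 1ℚ
sign-square zero    = refl
sign-square (suc k) = trans (square-neg (sign k)) (sign-square k)
  where
  square-neg : ∀ s → s * - 1ℚ * (s * - 1ℚ) ≡ s * s
  square-neg = solve-∀ ℚ-ring

inv-sign : ∀ k → inv (sign k) ≡ sign k
inv-sign k = inv-unique (sign k) (sign k) (sign-square k)

^-neg : ∀ x k → (- x) ^ℚ k ≡ sign k * x ^ℚ k
^-neg x zero    = refl
^-neg x (suc k) = trans (cong (_* - x) (^-neg x k)) (regroup (sign k) (x ^ℚ k) x)
  where
  regroup : ∀ s p x → s * p * - x ≡ s * - 1ℚ * (p * x)
  regroup = solve-∀ ℚ-ring

poch-rising : ∀ a k → poch (⟦ a ⟧ + 1ℚ) k ≡ frac ((a ℕ.+ k) !) (a !)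
poch-rising a k = divide-⟦⟧ (poch (⟦ a ⟧ + 1ℚ) k) ⟦ (a ℕ.+ k) ! ⟧ (a !) {{a ℕₚ.!≢0}} (times-a! k)
  where
  open ≡-Reasoning
  times-a! : ∀ k → poch (⟦ a ⟧ + 1ℚ) k * ⟦ a ! ⟧ ≡ ⟦ (a ℕ.+ k) ! ⟧
  times-a! zero    = trans (ℚₚ.*-identityˡ ⟦ a ! ⟧) (cong (λ n → ⟦ n ! ⟧) (sym (ℕₚ.+-identityʳ a)))
  times-a! (suc k) = begin
    poch (⟦ a ⟧ + 1ℚ) k * (⟦ a ⟧ + 1ℚ + ⟦ k ⟧) * ⟦ a ! ⟧
      ≡⟨ regroup (poch (⟦ a ⟧ + 1ℚ) k) ⟦ a ⟧ ⟦ k ⟧ ⟦ a ! ⟧ ⟩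
    poch (⟦ a ⟧ + 1ℚ) k * ⟦ a ! ⟧ * (1ℚ + (⟦ a ⟧ + ⟦ k ⟧))
      ≡⟨ cong₂ _*_ (times-a! k) (sym (trans (ℕtoℚ-homo-+ 1 (a ℕ.+ k)) (cong (λ x → 1ℚ + x) (ℕtoℚ-homo-+ a k)))) ⟩
    ⟦ (a ℕ.+ k) ! ⟧ * ⟦ suc (a ℕ.+ k) ⟧
      ≡⟨ trans (ℕtoℚ-homo-* (suc (a ℕ.+ k)) ((a ℕ.+ k) !)) (ℚₚ.*-comm ⟦ suc (a ℕ.+ k) ⟧ ⟦ (a ℕ.+ k) ! ⟧) ⟨
    ⟦ suc (a ℕ.+ k) ! ⟧
      ≡⟨ cong (λ n → ⟦ n ! ⟧) (ℕₚ.+-suc a k) ⟨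
    ⟦ (a ℕ.+ suc k) ! ⟧ ∎
    where
    regroup : ∀ p a k f → p * (a + 1ℚ + k) * f ≡ p * f * (1ℚ + (a + k))
    regroup = solve-∀ ℚ-ring

poch-falling : ∀ m k → k ≤ m → poch (- ⟦ m ⟧) k ≡ sign k * frac (m !) ((m ∸ k) !)
poch-falling m k k≤m =
  trans (divide-⟦⟧ (poch (- ⟦ m ⟧) k) (sign k * ⟦ m ! ⟧) ((m ∸ k) !) {{(m ∸ k) ℕₚ.!≢0}} (times-rest k k≤m))
        (ℚₚ.*-assoc (sign k) ⟦ m ! ⟧ _)
  where
  open ≡-Reasoning
  times-rest : ∀ k → k ≤ m → poch (- ⟦ m ⟧) k * ⟦ (m ∸ k) ! ⟧ ≡ sign k * ⟦ m ! ⟧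
  times-rest zero    _   = refl
  times-rest (suc k) k<m = begin
    poch (- ⟦ m ⟧) k * (- ⟦ m ⟧ + ⟦ k ⟧) * ⟦ d ! ⟧
      ≡⟨ cong (λ x → poch (- ⟦ m ⟧) k * x * ⟦ d ! ⟧) m-k ⟩
    poch (- ⟦ m ⟧) k * (- ⟦ suc d ⟧) * ⟦ d ! ⟧
      ≡⟨ regroup (poch (- ⟦ m ⟧) k) ⟦ suc d ⟧ ⟦ d ! ⟧ ⟩
    poch (- ⟦ m ⟧) k * (⟦ suc d ⟧ * ⟦ d ! ⟧) * - 1ℚ
      ≡⟨ cong (λ x → poch (- ⟦ m ⟧) k * x * - 1ℚ) (ℕtoℚ-homo-* (suc d) (d !)) ⟨
    poch (- ⟦ m ⟧) k * ⟦ suc d ! ⟧ * - 1ℚ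
      ≡⟨ cong (λ x → poch (- ⟦ m ⟧) k * ⟦ x ! ⟧ * - 1ℚ) m∸k≡1+d ⟨
    poch (- ⟦ m ⟧) k * ⟦ (m ∸ k) ! ⟧ * - 1ℚ
      ≡⟨ cong (_* - 1ℚ) (times-rest k (ℕₚ.<⇒≤ k<m)) ⟩
    sign k * ⟦ m ! ⟧ * - 1ℚ
      ≡⟨ swap (sign k) ⟦ m ! ⟧ (- 1ℚ) ⟩
    sign k * - 1ℚ * ⟦ m ! ⟧ ∎
    where
    d = m ∸ suc k
    m∸k≡1+d : m ∸ k ≡ suc d
    m∸k≡1+d = ℕₚ.+-∸-assoc 1 k<m
    negate-difference : ∀ x y → - x + y ≡ - (x - y)
    negate-difference = solve-∀ ℚ-ring
    m-k : - ⟦ m ⟧ + ⟦ k ⟧ ≡ - ⟦ suc d ⟧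
    m-k = begin
      - ⟦ m ⟧ + ⟦ k ⟧       ≡⟨ negate-difference ⟦ m ⟧ ⟦ k ⟧ ⟩
      - (⟦ m ⟧ - ⟦ k ⟧)     ≡⟨ cong -_ (ℕtoℚ-∸ (ℕₚ.<⇒≤ k<m)) ⟨
      - ⟦ m ∸ k ⟧           ≡⟨ cong (λ x → - ⟦ x ⟧) m∸k≡1+d ⟩
      - ⟦ suc d ⟧           ∎
    regroup : ∀ p s f → p * (- s) * f ≡ p * (s * f) * - 1ℚ
    regroup = solve-∀ ℚ-ring
    swap : ∀ s f x → s * f * x ≡ s * x * f
    swap = solve-∀ ℚ-ring

hypTerm : ℚ → ℚ → ℚ → ℚ → ℕ → ℚ
hypTerm a b c z k = ((poch a k * poch b k) // (poch c k * ⟦ k ! ⟧)) * z ^ℚ k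

hypTerm₁-closed : ∀ m x n k → k ≤ m →
  hypTerm (- ⟦ m ⟧) (⟦ x ⟧ + 1ℚ) (⟦ n ⟧ + 1ℚ) (- inv ⟦ 4 ⟧) k
    ≡ frac (m ! ℕ.* (x ℕ.+ k) ! ℕ.* n !) ((m ∸ k) ! ℕ.* x ! ℕ.* (n ℕ.+ k) ! ℕ.* k ! ℕ.* 4 ℕ.^ k)
hypTerm₁-closed m x n k k≤m = begin
  hypTerm (- ⟦ m ⟧) (⟦ x ⟧ + 1ℚ) (⟦ n ⟧ + 1ℚ) (- inv ⟦ 4 ⟧) k
    ≡⟨ cong (_* (- inv ⟦ 4 ⟧) ^ℚ k)
            (//-inv (poch (- ⟦ m ⟧) k * poch (⟦ x ⟧ + 1ℚ) k) (poch (⟦ n ⟧ + 1ℚ) k * ⟦ k ! ⟧)) ⟩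
  poch (- ⟦ m ⟧) k * poch (⟦ x ⟧ + 1ℚ) k * inv (poch (⟦ n ⟧ + 1ℚ) k * ⟦ k ! ⟧) * (- inv ⟦ 4 ⟧) ^ℚ k
    ≡⟨ cong₂ _*_ (cong₂ (λ a c → a * inv (c * ⟦ k ! ⟧))
                        (cong₂ _*_ (poch-falling m k k≤m) (poch-rising x k)) (poch-rising n k)) z^k ⟩
  s * F₁ * F₂ * inv (F₃ * ⟦ k ! ⟧) * (s * F₄)
    ≡⟨ pull-signs s F₁ F₂ (inv (F₃ * ⟦ k ! ⟧)) F₄ ⟩
  s * s * (F₁ * F₂ * inv (F₃ * ⟦ k ! ⟧) * F₄)
    ≡⟨ trans (cong (_* (F₁ * F₂ * inv (F₃ * ⟦ k ! ⟧) * F₄)) (sign-square k)) (ℚₚ.*-identityˡ _) ⟩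
  F₁ * F₂ * inv (F₃ * ⟦ k ! ⟧) * F₄
    ≡⟨ cong₂ (λ a b → a * inv (F₃ * b) * F₄) (sym (frac-* (m !) ((m ∸ k) !) ((x ℕ.+ k) !) (x !))) (frac-1 (k !)) ⟨
  frac (m ! ℕ.* (x ℕ.+ k) !) ((m ∸ k) ! ℕ.* x !) * inv (F₃ * frac (k !) 1) * F₄
    ≡⟨ cong (λ a → frac (m ! ℕ.* (x ℕ.+ k) !) ((m ∸ k) ! ℕ.* x !) * a * F₄)
            (trans (cong inv (frac-* ((n ℕ.+ k) !) (n !) (k !) 1)) (frac-inv ((n ℕ.+ k) ! ℕ.* k !) (n ! ℕ.* 1))) ⟩
  frac (m ! ℕ.* (x ℕ.+ k) !) ((m ∸ k) ! ℕ.* x !) * frac (n ! ℕ.* 1) ((n ℕ.+ k) ! ℕ.* k !) * F₄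
    ≡⟨ trans (cong (_* F₄) (frac-* (m ! ℕ.* (x ℕ.+ k) !) ((m ∸ k) ! ℕ.* x !) (n ! ℕ.* 1) ((n ℕ.+ k) ! ℕ.* k !)))
             (frac-* (m ! ℕ.* (x ℕ.+ k) ! ℕ.* (n ! ℕ.* 1)) ((m ∸ k) ! ℕ.* x ! ℕ.* ((n ℕ.+ k) ! ℕ.* k !)) 1 (4 ℕ.^ k)) ⟩
  frac (m ! ℕ.* (x ℕ.+ k) ! ℕ.* (n ! ℕ.* 1) ℕ.* 1) ((m ∸ k) ! ℕ.* x ! ℕ.* ((n ℕ.+ k) ! ℕ.* k !) ℕ.* 4 ℕ.^ k)
    ≡⟨ cong₂ frac (tidy₁ (m !) ((x ℕ.+ k) !) (n !)) (tidy₂ ((m ∸ k) !) (x !) ((n ℕ.+ k) !) (k !) (4 ℕ.^ k)) ⟩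
  frac (m ! ℕ.* (x ℕ.+ k) ! ℕ.* n !) ((m ∸ k) ! ℕ.* x ! ℕ.* (n ℕ.+ k) ! ℕ.* k ! ℕ.* 4 ℕ.^ k) ∎
  where
  open ≡-Reasoning
  s  = sign k
  F₁ = frac (m !) ((m ∸ k) !)
  F₂ = frac ((x ℕ.+ k) !) (x !)
  F₃ = frac ((n ℕ.+ k) !) (n !)
  F₄ = frac 1 (4 ℕ.^ k)
  z^k : (- inv ⟦ 4 ⟧) ^ℚ k ≡ s * F₄
  z^k = begin
    (- inv ⟦ 4 ⟧) ^ℚ k       ≡⟨ ^-neg (inv ⟦ 4 ⟧) k ⟩
    s * inv ⟦ 4 ⟧ ^ℚ k       ≡⟨ cong (s *_) (trans (inv-^ ⟦ 4 ⟧ k) (cong inv (ℕtoℚ-homo-^ 4 k))) ⟩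
    s * inv ⟦ 4 ℕ.^ k ⟧      ≡⟨ cong (s *_) (ℚₚ.*-identityˡ _) ⟨
    s * F₄                   ∎
  pull-signs : ∀ s a b c d → s * a * b * c * (s * d) ≡ s * s * (a * b * c * d)
  pull-signs = solve-∀ ℚ-ring
  tidy₁ : ∀ a b c → a ℕ.* b ℕ.* (c ℕ.* 1) ℕ.* 1 ≡ a ℕ.* b ℕ.* c
  tidy₁ = ℕ-solve-∀
  tidy₂ : ∀ a b c d e → a ℕ.* b ℕ.* (c ℕ.* d) ℕ.* e ≡ a ℕ.* b ℕ.* c ℕ.* d ℕ.* e
  tidy₂ = ℕ-solve-∀

hypTerm₂-closed : ∀ m y j k → k ≤ m → k ≤ y → k ≤ j →
  hypTerm (- ⟦ m ⟧) (- ⟦ y ⟧) (- ⟦ j ⟧) (- ⟦ 4 ⟧) k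
    ≡ frac (m ! ℕ.* y ! ℕ.* (j ∸ k) ! ℕ.* 4 ℕ.^ k) ((m ∸ k) ! ℕ.* (y ∸ k) ! ℕ.* j ! ℕ.* k !)
hypTerm₂-closed m y j k k≤m k≤y k≤j = begin
  hypTerm (- ⟦ m ⟧) (- ⟦ y ⟧) (- ⟦ j ⟧) (- ⟦ 4 ⟧) k
    ≡⟨ cong (_* (- ⟦ 4 ⟧) ^ℚ k) (//-inv (poch (- ⟦ m ⟧) k * poch (- ⟦ y ⟧) k) (poch (- ⟦ j ⟧) k * ⟦ k ! ⟧)) ⟩
  poch (- ⟦ m ⟧) k * poch (- ⟦ y ⟧) k * inv (poch (- ⟦ j ⟧) k * ⟦ k ! ⟧) * (- ⟦ 4 ⟧) ^ℚ k
    ≡⟨ cong₂ _*_ (cong₂ (λ a c → a * inv (c * ⟦ k ! ⟧))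
                        (cong₂ _*_ (poch-falling m k k≤m) (poch-falling y k k≤y)) (poch-falling j k k≤j)) z^k ⟩
  s * F₁ * (s * F₂) * inv (s * F₃ * ⟦ k ! ⟧) * (s * ⟦ 4 ℕ.^ k ⟧)
    ≡⟨ cong (λ a → s * F₁ * (s * F₂) * a * (s * ⟦ 4 ℕ.^ k ⟧)) inverse ⟩
  s * F₁ * (s * F₂) * (s * frac ((j ∸ k) !) (j !) * frac 1 (k !)) * (s * ⟦ 4 ℕ.^ k ⟧)
    ≡⟨ pull-signs s F₁ F₂ (frac ((j ∸ k) !) (j !)) (frac 1 (k !)) ⟦ 4 ℕ.^ k ⟧ ⟩
  s * s * (s * s) * (F₁ * F₂ * frac ((j ∸ k) !) (j !) * frac 1 (k !) * ⟦ 4 ℕ.^ k ⟧)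
    ≡⟨ trans (cong (_* body) (cong₂ _*_ (sign-square k) (sign-square k))) (ℚₚ.*-identityˡ body) ⟩
  F₁ * F₂ * frac ((j ∸ k) !) (j !) * frac 1 (k !) * ⟦ 4 ℕ.^ k ⟧
    ≡⟨ cong (F₁ * F₂ * frac ((j ∸ k) !) (j !) * frac 1 (k !) *_) (frac-1 (4 ℕ.^ k)) ⟨
  F₁ * F₂ * frac ((j ∸ k) !) (j !) * frac 1 (k !) * frac (4 ℕ.^ k) 1
    ≡⟨ combine ⟩
  frac (m ! ℕ.* y ! ℕ.* (j ∸ k) ! ℕ.* 1 ℕ.* 4 ℕ.^ k) ((m ∸ k) ! ℕ.* (y ∸ k) ! ℕ.* j ! ℕ.* k ! ℕ.* 1)
    ≡⟨ cong₂ frac (cong (ℕ._* 4 ℕ.^ k) (ℕₚ.*-identityʳ (m ! ℕ.* y ! ℕ.* (j ∸ k) !)))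
                   (ℕₚ.*-identityʳ ((m ∸ k) ! ℕ.* (y ∸ k) ! ℕ.* j ! ℕ.* k !)) ⟩
  frac (m ! ℕ.* y ! ℕ.* (j ∸ k) ! ℕ.* 4 ℕ.^ k) ((m ∸ k) ! ℕ.* (y ∸ k) ! ℕ.* j ! ℕ.* k !) ∎
  where
  open ≡-Reasoning
  s  = sign k
  F₁ = frac (m !) ((m ∸ k) !)
  F₂ = frac (y !) ((y ∸ k) !)
  F₃ = frac (j !) ((j ∸ k) !)
  body = F₁ * F₂ * frac ((j ∸ k) !) (j !) * frac 1 (k !) * ⟦ 4 ℕ.^ k ⟧
  z^k : (- ⟦ 4 ⟧) ^ℚ k ≡ s * ⟦ 4 ℕ.^ k ⟧
  z^k = trans (^-neg ⟦ 4 ⟧ k) (cong (s *_) (ℕtoℚ-homo-^ 4 k))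
  inverse : inv (s * F₃ * ⟦ k ! ⟧) ≡ s * frac ((j ∸ k) !) (j !) * frac 1 (k !)
  inverse = begin
    inv (s * F₃ * ⟦ k ! ⟧)          ≡⟨ inv-* (s * F₃) ⟦ k ! ⟧ ⟩
    inv (s * F₃) * inv ⟦ k ! ⟧      ≡⟨ cong₂ _*_ (trans (inv-* s F₃) (cong₂ _*_ (inv-sign k) (frac-inv (j !) ((j ∸ k) !))))
                                                 (sym (ℚₚ.*-identityˡ (inv ⟦ k ! ⟧))) ⟩
    s * frac ((j ∸ k) !) (j !) * frac 1 (k !) ∎
  pull-signs : ∀ s a b c d e → s * a * (s * b) * (s * c * d) * (s * e) ≡ s * s * (s * s) * (a * b * c * d * e)
  pull-signs = solve-∀ ℚ-ring
  combine : F₁ * F₂ * frac ((j ∸ k) !) (j !) * frac 1 (k !) * frac (4 ℕ.^ k) 1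
          ≡ frac (m ! ℕ.* y ! ℕ.* (j ∸ k) ! ℕ.* 1 ℕ.* 4 ℕ.^ k) ((m ∸ k) ! ℕ.* (y ∸ k) ! ℕ.* j ! ℕ.* k ! ℕ.* 1)
  combine = begin
    F₁ * F₂ * frac ((j ∸ k) !) (j !) * frac 1 (k !) * frac (4 ℕ.^ k) 1
      ≡⟨ cong (λ a → a * frac ((j ∸ k) !) (j !) * frac 1 (k !) * frac (4 ℕ.^ k) 1) (frac-* (m !) ((m ∸ k) !) (y !) ((y ∸ k) !)) ⟩
    frac (m ! ℕ.* y !) ((m ∸ k) ! ℕ.* (y ∸ k) !) * frac ((j ∸ k) !) (j !) * frac 1 (k !) * frac (4 ℕ.^ k) 1
      ≡⟨ cong (λ a → a * frac 1 (k !) * frac (4 ℕ.^ k) 1) (frac-* (m ! ℕ.* y !) ((m ∸ k) ! ℕ.* (y ∸ k) !) ((j ∸ k) !) (j !)) ⟩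
    frac (m ! ℕ.* y ! ℕ.* (j ∸ k) !) ((m ∸ k) ! ℕ.* (y ∸ k) ! ℕ.* j !) * frac 1 (k !) * frac (4 ℕ.^ k) 1
      ≡⟨ cong (_* frac (4 ℕ.^ k) 1) (frac-* (m ! ℕ.* y ! ℕ.* (j ∸ k) !) ((m ∸ k) ! ℕ.* (y ∸ k) ! ℕ.* j !) 1 (k !)) ⟩
    frac (m ! ℕ.* y ! ℕ.* (j ∸ k) ! ℕ.* 1) ((m ∸ k) ! ℕ.* (y ∸ k) ! ℕ.* j ! ℕ.* k !) * frac (4 ℕ.^ k) 1
      ≡⟨ frac-* (m ! ℕ.* y ! ℕ.* (j ∸ k) ! ℕ.* 1) ((m ∸ k) ! ℕ.* (y ∸ k) ! ℕ.* j ! ℕ.* k !) (4 ℕ.^ k) 1 ⟩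
    frac (m ! ℕ.* y ! ℕ.* (j ∸ k) ! ℕ.* 1 ℕ.* 4 ℕ.^ k) ((m ∸ k) ! ℕ.* (y ∸ k) ! ℕ.* j ! ℕ.* k ! ℕ.* 1) ∎

sumTo-cong : ∀ m {f g : ℕ → ℚ} → (∀ k → k ≤ m → f k ≡ g k) → sumTo m f ≡ sumTo m g
sumTo-cong zero    f≗g = f≗g 0 ℕ.z≤n
sumTo-cong (suc m) f≗g =
  cong₂ _+_ (sumTo-cong m (λ k k≤m → f≗g k (ℕₚ.m≤n⇒m≤1+n k≤m))) (f≗g (suc m) ℕₚ.≤-refl)

sumTo-*ˡ : ∀ m c (f : ℕ → ℚ) → c * sumTo m f ≡ sumTo m (λ k → c * f k)
sumTo-*ˡ zero    c f = refl
sumTo-*ˡ (suc m) c f =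
  trans (ℚₚ.*-distribˡ-+ c (sumTo m f) (f (suc m))) (cong (_+ c * f (suc m)) (sumTo-*ˡ m c f))

sumTo-+ : ∀ m (f g : ℕ → ℚ) → sumTo m (λ k → f k + g k) ≡ sumTo m f + sumTo m g
sumTo-+ zero    f g = refl
sumTo-+ (suc m) f g = trans (cong (_+ (f (suc m) + g (suc m))) (sumTo-+ m f g))
                            (+-interchange (sumTo m f) (sumTo m g) (f (suc m)) (g (suc m)))
  where
  +-interchange : ∀ a b c d → a + b + (c + d) ≡ a + c + (b + d)
  +-interchange = solve-∀ ℚ-ring

sumTo-shift : ∀ m (f : ℕ → ℚ) → sumTo (suc m) f ≡ f 0 + sumTo m (λ k → f (suc k))
sumTo-shift zero    f = refl
sumTo-shift (suc m) f = trans (cong (_+ f (suc (suc m))) (sumTo-shift m f)) (ℚₚ.+-assoc (f 0) _ _)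

sumTo-reverse : ∀ m (f : ℕ → ℚ) → sumTo m f ≡ sumTo m (λ k → f (m ∸ k))
sumTo-reverse zero    f = refl
sumTo-reverse (suc m) f = begin
  sumTo m f + f (suc m)                   ≡⟨ cong (_+ f (suc m)) (sumTo-reverse m f) ⟩
  sumTo m (λ k → f (m ∸ k)) + f (suc m)   ≡⟨ ℚₚ.+-comm _ (f (suc m)) ⟩
  f (suc m) + sumTo m (λ k → f (m ∸ k))   ≡⟨ sumTo-shift m (λ k → f (suc m ∸ k)) ⟨
  sumTo (suc m) (λ k → f (suc m ∸ k))     ∎
  where open ≡-Reasoning

sumTo-exchange : ∀ M (f : ℕ → ℕ → ℚ) →
  sumTo M (λ m → sumTo m (f m)) ≡ sumTo M (λ k → sumTo (M ∸ k) (λ r → f (k ℕ.+ r) k))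
sumTo-exchange zero    f = refl
sumTo-exchange (suc M) f = begin
  sumTo M (λ m → sumTo m (f m)) + sumTo (suc M) (f (suc M))
    ≡⟨ cong (_+ sumTo (suc M) (f (suc M))) (sumTo-exchange M f) ⟩
  sumTo M (λ k → row M k) + (sumTo M (f (suc M)) + f (suc M) (suc M))
    ≡⟨ ℚₚ.+-assoc (sumTo M (λ k → row M k)) _ _ ⟨
  sumTo M (λ k → row M k) + sumTo M (f (suc M)) + f (suc M) (suc M)
    ≡⟨ cong (_+ f (suc M) (suc M)) (sumTo-+ M (λ k → row M k) (f (suc M))) ⟨
  sumTo M (λ k → row M k + f (suc M) k) + f (suc M) (suc M)
    ≡⟨ cong₂ _+_ (sumTo-cong M row-extend) diagonal ⟨
  sumTo (suc M) (λ k → row (suc M) k) ∎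
  where
  open ≡-Reasoning
  row : ℕ → ℕ → ℚ
  row M k = sumTo (M ∸ k) (λ r → f (k ℕ.+ r) k)
  diagonal : row (suc M) (suc M) ≡ f (suc M) (suc M)
  diagonal = trans (cong (λ i → sumTo i (λ r → f (suc M ℕ.+ r) (suc M))) (ℕₚ.n∸n≡0 M))
                   (cong (λ n → f n (suc M)) (ℕₚ.+-identityʳ (suc M)))
  row-extend : ∀ k → k ≤ M → row (suc M) k ≡ row M k + f (suc M) k
  row-extend k k≤M rewrite ℕₚ.+-∸-assoc 1 k≤M =
    cong (λ n → row M k + f n k) (trans (ℕₚ.+-suc k (M ∸ k)) (cong suc (ℕₚ.m+[n∸m]≡n k≤M)))

sumTo-by-difference : ∀ M (f : ℕ → ℕ → ℚ) →
  sumTo M (λ m → sumTo m (f m)) ≡ sumTo M (λ i → sumTo (M ∸ i) (λ r → f (i ℕ.+ r) r))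
sumTo-by-difference M f = begin
  sumTo M (λ m → sumTo m (f m))
    ≡⟨ sumTo-cong M (λ m _ → sumTo-reverse m (f m)) ⟩
  sumTo M (λ m → sumTo m (λ k → f m (m ∸ k)))
    ≡⟨ sumTo-exchange M (λ m k → f m (m ∸ k)) ⟩
  sumTo M (λ i → sumTo (M ∸ i) (λ r → f (i ℕ.+ r) (i ℕ.+ r ∸ i)))
    ≡⟨ sumTo-cong M (λ i _ → sumTo-cong (M ∸ i) (λ r _ → cong (f (i ℕ.+ r)) (ℕₚ.m+n∸m≡n i r))) ⟩
  sumTo M (λ i → sumTo (M ∸ i) (λ r → f (i ℕ.+ r) r)) ∎
  where open ≡-Reasoning

ℕtoℚ-sumToℕ : ∀ m f → ⟦ sumToℕ m f ⟧ ≡ sumTo m (λ k → ⟦ f k ⟧)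
ℕtoℚ-sumToℕ zero    f = refl
ℕtoℚ-sumToℕ (suc m) f = trans (ℕtoℚ-homo-+ (sumToℕ m f) (f (suc m))) (cong (_+ ⟦ f (suc m) ⟧) (ℕtoℚ-sumToℕ m f))

⟦fib⟧≡sumTo-binomials : ∀ j → ⟦ fib (suc j) ⟧ ≡ sumTo ⌊ j /2⌋ (λ i → ⟦ (j ∸ i) C i ⟧)
⟦fib⟧≡sumTo-binomials j = trans (cong ⟦_⟧ (fib≡sum-binomials j)) (ℕtoℚ-sumToℕ ⌊ j /2⌋ (λ i → (j ∸ i) C i))

sumTo-collapse-inner : ∀ M (a : ℕ → ℚ) (g : ℕ → ℕ → ℕ) →
  sumTo M (λ i → sumTo (M ∸ i) (λ r → a i * ⟦ g i r ⟧)) ≡ sumTo M (λ i → a i * ⟦ sumToℕ (M ∸ i) (g i) ⟧)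
sumTo-collapse-inner M a g = sumTo-cong M (λ i _ →
  trans (sym (sumTo-*ˡ (M ∸ i) (a i) (λ r → ⟦ g i r ⟧))) (cong (a i *_) (sym (ℕtoℚ-sumToℕ (M ∸ i) (g i)))))

triangle-bound : ∀ {j i r} → i ≤ ⌊ j /2⌋ → r ≤ ⌊ j /2⌋ ∸ i → 2 ℕ.* (i ℕ.+ r) ≤ j
triangle-bound {j} {i} i≤ r≤ =
  ≤⌊n/2⌋⇒2*≤n (ℕₚ.≤-trans (ℕₚ.+-monoʳ-≤ i r≤) (ℕₚ.≤-reflexive (ℕₚ.m+[n∸m]≡n i≤)))

-- The first identity

2^ℤ[1-n] : ∀ n → ⟦ 2 ⟧ ^ℤ (+ 1 ℤ.+ ℤ.- (+ n)) ≡ frac 2 (2 ℕ.^ n)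
2^ℤ[1-n] zero          = refl
2^ℤ[1-n] (suc zero)    = refl
2^ℤ[1-n] (suc (suc n)) = begin
  inv (⟦ 2 ⟧ ^ℚ suc n)                       ≡⟨ cong inv (ℕtoℚ-homo-^ 2 (suc n)) ⟩
  inv ⟦ 2 ℕ.^ suc n ⟧                        ≡⟨ ℚₚ.*-identityˡ _ ⟨
  1ℚ * inv ⟦ 2 ℕ.^ suc n ⟧                   ≡⟨ cong (_* inv ⟦ 2 ℕ.^ suc n ⟧) (*-inverseʳ ⟦ 2 ⟧ (ℕtoℚ-≢0 2)) ⟨
  ⟦ 2 ⟧ * inv ⟦ 2 ⟧ * inv ⟦ 2 ℕ.^ suc n ⟧    ≡⟨ ℚₚ.*-assoc ⟦ 2 ⟧ (inv ⟦ 2 ⟧) (inv ⟦ 2 ℕ.^ suc n ⟧) ⟩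
  ⟦ 2 ⟧ * (inv ⟦ 2 ⟧ * inv ⟦ 2 ℕ.^ suc n ⟧)  ≡⟨ cong (⟦ 2 ⟧ *_) split ⟨
  ⟦ 2 ⟧ * inv ⟦ 2 ℕ.^ suc (suc n) ⟧          ∎
  where
  open ≡-Reasoning
  split : inv ⟦ 2 ℕ.* 2 ℕ.^ suc n ⟧ ≡ inv ⟦ 2 ⟧ * inv ⟦ 2 ℕ.^ suc n ⟧
  split = trans (cong inv (ℕtoℚ-homo-* 2 (2 ℕ.^ suc n))) (inv-* ⟦ 2 ⟧ ⟦ 2 ℕ.^ suc n ⟧)

1/cc*2≡foldWeight : ∀ n → (1ℚ // cc n) * ⟦ 2 ⟧ ≡ ⟦ foldWeight n ⟧
1/cc*2≡foldWeight zero    = refl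
1/cc*2≡foldWeight (suc n) = refl

coefficient₁ : ℕ → ℕ → ℚ
coefficient₁ j m = (1ℚ // cc (j ∸ 2 ℕ.* m)) * ⟦ (j ∸ m) C (j ∸ 2 ℕ.* m) ⟧
                   * (⟦ 2 ⟧ ^ℤ ((ℤ.- (+ j)) ℤ.+ (+ (2 ℕ.* m)) ℤ.+ (+ 1)))

coefficient₁-normal : ∀ n m → coefficient₁ (2 ℕ.* m ℕ.+ n) m ≡ frac (foldWeight n) (2 ℕ.^ n) * ⟦ (n ℕ.+ m) C n ⟧
coefficient₁-normal n m = begin
  (1ℚ // cc (j ∸ 2 ℕ.* m)) * ⟦ (j ∸ m) C (j ∸ 2 ℕ.* m) ⟧ * (⟦ 2 ⟧ ^ℤ ((ℤ.- (+ j)) ℤ.+ (+ (2 ℕ.* m)) ℤ.+ (+ 1)))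
    ≡⟨ cong₂ (λ a b → (1ℚ // cc a) * ⟦ b C a ⟧ * (⟦ 2 ⟧ ^ℤ ((ℤ.- (+ j)) ℤ.+ (+ (2 ℕ.* m)) ℤ.+ (+ 1))))
             (ℕₚ.m+n∸m≡n (2 ℕ.* m) n) (2*m+n∸m≡n+m m n) ⟩
  (1ℚ // cc n) * B * (⟦ 2 ⟧ ^ℤ ((ℤ.- (+ j)) ℤ.+ (+ (2 ℕ.* m)) ℤ.+ (+ 1)))
    ≡⟨ cong (λ e → (1ℚ // cc n) * B * (⟦ 2 ⟧ ^ℤ e)) exponent ⟩
  (1ℚ // cc n) * B * (⟦ 2 ⟧ ^ℤ (+ 1 ℤ.+ ℤ.- (+ n)))
    ≡⟨ cong ((1ℚ // cc n) * B *_) (2^ℤ[1-n] n) ⟩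
  (1ℚ // cc n) * B * (⟦ 2 ⟧ * inv ⟦ 2 ℕ.^ n ⟧)
    ≡⟨ regroup (1ℚ // cc n) B ⟦ 2 ⟧ (inv ⟦ 2 ℕ.^ n ⟧) ⟩
  (1ℚ // cc n) * ⟦ 2 ⟧ * inv ⟦ 2 ℕ.^ n ⟧ * B
    ≡⟨ cong (λ w → w * inv ⟦ 2 ℕ.^ n ⟧ * B) (1/cc*2≡foldWeight n) ⟩
  frac (foldWeight n) (2 ℕ.^ n) * B ∎
  where
  open ≡-Reasoning
  j = 2 ℕ.* m ℕ.+ n
  B = ⟦ (n ℕ.+ m) C n ⟧
  exponent : (ℤ.- (+ j)) ℤ.+ (+ (2 ℕ.* m)) ℤ.+ (+ 1) ≡ + 1 ℤ.+ ℤ.- (+ n)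
  exponent = trans (cong (λ x → ℤ.- x ℤ.+ (+ (2 ℕ.* m)) ℤ.+ + 1) (ℤₚ.pos-+ (2 ℕ.* m) n))
                   (cancel (+ (2 ℕ.* m)) (+ n))
    where
    cancel : ∀ a b → ℤ.- (a ℤ.+ b) ℤ.+ a ℤ.+ + 1 ≡ + 1 ℤ.+ ℤ.- b
    cancel = ℤ-solve-∀
  regroup : ∀ w c t p → w * c * (t * p) ≡ w * t * p * c
  regroup = solve-∀ ℚ-ring

shifted-by-m : ∀ n m → ⟦ 2 ℕ.* m ℕ.+ n ⟧ - ⟦ m ⟧ + 1ℚ ≡ ⟦ n ℕ.+ m ⟧ + 1ℚ
shifted-by-m n m = trans (cong (_+ 1ℚ) (sym (ℕtoℚ-∸ (ℕₚ.≤-trans (ℕₚ.m≤m+n m (m ℕ.+ 0)) (ℕₚ.m≤m+n (2 ℕ.* m) n)))))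
                         (cong (λ x → ⟦ x ⟧ + 1ℚ) (2*m+n∸m≡n+m m n))

shifted-by-2m : ∀ n m → ⟦ 2 ℕ.* m ℕ.+ n ⟧ - ⟦ 2 ℕ.* m ⟧ + 1ℚ ≡ ⟦ n ⟧ + 1ℚ
shifted-by-2m n m = trans (cong (_+ 1ℚ) (sym (ℕtoℚ-∸ (ℕₚ.m≤m+n (2 ℕ.* m) n))))
                          (cong (λ x → ⟦ x ⟧ + 1ℚ) (ℕₚ.m+n∸m≡n (2 ℕ.* m) n))

term₁ : ℕ → ℕ → ℕ → ℚ
term₁ j m k = coefficient₁ j m * hypTerm (- ⟦ m ⟧) (⟦ j ⟧ - ⟦ m ⟧ + 1ℚ) (⟦ j ⟧ - ⟦ 2 ℕ.* m ⟧ + 1ℚ) (- inv ⟦ 4 ⟧) k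

term₁-normal : ∀ n m k → term₁ (2 ℕ.* m ℕ.+ n) m k
  ≡ frac (foldWeight n) (2 ℕ.^ n) * ⟦ (n ℕ.+ m) C n ⟧
    * hypTerm (- ⟦ m ⟧) (⟦ n ℕ.+ m ⟧ + 1ℚ) (⟦ n ⟧ + 1ℚ) (- inv ⟦ 4 ⟧) k
term₁-normal n m k = cong₂ _*_ (coefficient₁-normal n m)
  (cong₂ (λ b c → hypTerm (- ⟦ m ⟧) b c (- inv ⟦ 4 ⟧) k) (shifted-by-m n m) (shifted-by-2m n m))

module _ (n i r : ℕ) where
  private
    m = i ℕ.+ r
    N = r ℕ.+ (n ℕ.+ r)
    w = foldWeight n
    P = 2 ℕ.^ n
    Q = 4 ℕ.^ r
    A = (n ℕ.+ m) !
    E = (n ℕ.+ r) !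
    F = (i ℕ.+ N) !
    H = N !

  term₁-factorials : term₁ (2 ℕ.* (i ℕ.+ r) ℕ.+ n) (i ℕ.+ r) r
    ≡ frac (w ℕ.* A ℕ.* (m ! ℕ.* F ℕ.* n !)) (P ℕ.* (n ! ℕ.* m !) ℕ.* (i ! ℕ.* A ℕ.* E ℕ.* r ! ℕ.* Q))
  term₁-factorials = begin
    term₁ (2 ℕ.* (i ℕ.+ r) ℕ.+ n) (i ℕ.+ r) r
      ≡⟨ term₁-normal n (i ℕ.+ r) r ⟩
    frac w P * ⟦ (n ℕ.+ m) C n ⟧ * hypTerm (- ⟦ m ⟧) (⟦ n ℕ.+ m ⟧ + 1ℚ) (⟦ n ⟧ + 1ℚ) (- inv ⟦ 4 ⟧) r
      ≡⟨ cong₂ (λ b t → frac w P * b * t) (ℕtoℚ-C n m refl) (hypTerm₁-closed m (n ℕ.+ m) n r (ℕₚ.m≤n+m r i)) ⟩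
    frac w P * frac A (n ! ℕ.* m !) * frac (m ! ℕ.* (n ℕ.+ m ℕ.+ r) ! ℕ.* n !) ((m ∸ r) ! ℕ.* A ℕ.* E ℕ.* r ! ℕ.* Q)
      ≡⟨ cong₂ (λ a b → frac w P * frac A (n ! ℕ.* m !) * frac (m ! ℕ.* a ! ℕ.* n !) (b ! ℕ.* A ℕ.* E ℕ.* r ! ℕ.* Q))
               reindex (ℕₚ.m+n∸n≡m i r) ⟩
    frac w P * frac A (n ! ℕ.* m !) * frac (m ! ℕ.* F ℕ.* n !) (i ! ℕ.* A ℕ.* E ℕ.* r ! ℕ.* Q)
      ≡⟨ trans (cong (_* frac (m ! ℕ.* F ℕ.* n !) (i ! ℕ.* A ℕ.* E ℕ.* r ! ℕ.* Q)) (frac-* w P A (n ! ℕ.* m !)))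
               (frac-* (w ℕ.* A) (P ℕ.* (n ! ℕ.* m !)) (m ! ℕ.* F ℕ.* n !) (i ! ℕ.* A ℕ.* E ℕ.* r ! ℕ.* Q)) ⟩
    frac (w ℕ.* A ℕ.* (m ! ℕ.* F ℕ.* n !)) (P ℕ.* (n ! ℕ.* m !) ℕ.* (i ! ℕ.* A ℕ.* E ℕ.* r ! ℕ.* Q)) ∎
    where
    open ≡-Reasoning
    reindex : n ℕ.+ (i ℕ.+ r) ℕ.+ r ≡ i ℕ.+ (r ℕ.+ (n ℕ.+ r))
    reindex = ℕ-solve (n ∷ i ∷ r ∷ [])

  diagonal₁-factorials :
    frac ((2 ℕ.* (i ℕ.+ r) ℕ.+ n ∸ i) C i) (2 ℕ.^ (2 ℕ.* (i ℕ.+ r) ℕ.+ n ∸ 2 ℕ.* i))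
      * ⟦ ((2 ℕ.* (i ℕ.+ r) ℕ.+ n ∸ 2 ℕ.* i) C r) ℕ.* foldWeight (2 ℕ.* (i ℕ.+ r) ℕ.+ n ∸ 2 ℕ.* i ∸ 2 ℕ.* r) ⟧
    ≡ frac (F ℕ.* H ℕ.* w) (i ! ℕ.* H ℕ.* (r ! ℕ.* E) ℕ.* (P ℕ.* Q))
  diagonal₁-factorials = begin
    frac ((2 ℕ.* (i ℕ.+ r) ℕ.+ n ∸ i) C i) (2 ℕ.^ (2 ℕ.* (i ℕ.+ r) ℕ.+ n ∸ 2 ℕ.* i))
      * ⟦ ((2 ℕ.* (i ℕ.+ r) ℕ.+ n ∸ 2 ℕ.* i) C r) ℕ.* foldWeight (2 ℕ.* (i ℕ.+ r) ℕ.+ n ∸ 2 ℕ.* i ∸ 2 ℕ.* r) ⟧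
      ≡⟨ cong₂ (λ a b → frac (a C i) (2 ℕ.^ b) * ⟦ (b C r) ℕ.* foldWeight (b ∸ 2 ℕ.* r) ⟧)
               (m≡n+o⇒m∸n≡o i (i ℕ.+ N) j≡i+[i+N]) (m≡n+o⇒m∸n≡o (2 ℕ.* i) N j≡2i+N) ⟩
    frac ((i ℕ.+ N) C i) (2 ℕ.^ N) * ⟦ (N C r) ℕ.* foldWeight (N ∸ 2 ℕ.* r) ⟧
      ≡⟨ cong (λ x → frac ((i ℕ.+ N) C i) (2 ℕ.^ N) * ⟦ (N C r) ℕ.* foldWeight x ⟧) (m≡n+o⇒m∸n≡o (2 ℕ.* r) n N≡2r+n) ⟩
    frac ((i ℕ.+ N) C i) (2 ℕ.^ N) * ⟦ (N C r) ℕ.* w ⟧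
      ≡⟨ cong₂ (λ a b → ⟦ (i ℕ.+ N) C i ⟧ * inv ⟦ a ⟧ * b)
               (trans (cong (2 ℕ.^_) N≡n+2r) (2^[n+2r]≡2^n*4^r n r)) (ℕtoℚ-homo-* (N C r) w) ⟩
    ⟦ (i ℕ.+ N) C i ⟧ * inv ⟦ P ℕ.* Q ⟧ * (⟦ N C r ⟧ * ⟦ w ⟧)
      ≡⟨ cong₂ (λ a b → a * inv ⟦ P ℕ.* Q ⟧ * (b * ⟦ w ⟧)) (ℕtoℚ-C i N refl) (ℕtoℚ-C r (n ℕ.+ r) refl) ⟩
    frac F (i ! ℕ.* H) * inv ⟦ P ℕ.* Q ⟧ * (frac H (r ! ℕ.* E) * ⟦ w ⟧)
      ≡⟨ regroup (frac F (i ! ℕ.* H)) (inv ⟦ P ℕ.* Q ⟧) (frac H (r ! ℕ.* E)) ⟦ w ⟧ ⟩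
    frac F (i ! ℕ.* H) * frac H (r ! ℕ.* E) * frac w (P ℕ.* Q)
      ≡⟨ cong (_* frac w (P ℕ.* Q)) (frac-* F (i ! ℕ.* H) H (r ! ℕ.* E)) ⟩
    frac (F ℕ.* H) (i ! ℕ.* H ℕ.* (r ! ℕ.* E)) * frac w (P ℕ.* Q)
      ≡⟨ frac-* (F ℕ.* H) (i ! ℕ.* H ℕ.* (r ! ℕ.* E)) w (P ℕ.* Q) ⟩
    frac (F ℕ.* H ℕ.* w) (i ! ℕ.* H ℕ.* (r ! ℕ.* E) ℕ.* (P ℕ.* Q)) ∎
    where
    open ≡-Reasoning
    j≡i+[i+N] : 2 ℕ.* (i ℕ.+ r) ℕ.+ n ≡ i ℕ.+ (i ℕ.+ (r ℕ.+ (n ℕ.+ r)))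
    j≡i+[i+N] = ℕ-solve (i ∷ r ∷ n ∷ [])
    j≡2i+N : 2 ℕ.* (i ℕ.+ r) ℕ.+ n ≡ 2 ℕ.* i ℕ.+ (r ℕ.+ (n ℕ.+ r))
    j≡2i+N = ℕ-solve (i ∷ r ∷ n ∷ [])
    N≡2r+n : r ℕ.+ (n ℕ.+ r) ≡ 2 ℕ.* r ℕ.+ n
    N≡2r+n = ℕ-solve (r ∷ n ∷ [])
    N≡n+2r : r ℕ.+ (n ℕ.+ r) ≡ n ℕ.+ 2 ℕ.* r
    N≡n+2r = ℕ-solve (r ∷ n ∷ [])
    regroup : ∀ f p h w → f * p * (h * w) ≡ f * h * (w * p)
    regroup = solve-∀ ℚ-ring

  term₁-cross : frac (w ℕ.* A ℕ.* (m ! ℕ.* F ℕ.* n !)) (P ℕ.* (n ! ℕ.* m !) ℕ.* (i ! ℕ.* A ℕ.* E ℕ.* r ! ℕ.* Q))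
              ≡ frac (F ℕ.* H ℕ.* w) (i ! ℕ.* H ℕ.* (r ! ℕ.* E) ℕ.* (P ℕ.* Q))
  term₁-cross = frac-cross (w ℕ.* A ℕ.* (m ! ℕ.* F ℕ.* n !)) (P ℕ.* (n ! ℕ.* m !) ℕ.* (i ! ℕ.* A ℕ.* E ℕ.* r ! ℕ.* Q))
                           (F ℕ.* H ℕ.* w) (i ! ℕ.* H ℕ.* (r ! ℕ.* E) ℕ.* (P ℕ.* Q))
                           {{P≢0 ⊛ (n ℕₚ.!≢0 ⊛ m ℕₚ.!≢0) ⊛ (i ℕₚ.!≢0 ⊛ A≢0 ⊛ E≢0 ⊛ r ℕₚ.!≢0 ⊛ Q≢0)}}
                           {{i ℕₚ.!≢0 ⊛ H≢0 ⊛ (r ℕₚ.!≢0 ⊛ E≢0) ⊛ (P≢0 ⊛ Q≢0)}}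
                           (cross w A (m !) F (n !) (i !) H (r !) E P Q)
    where
    P≢0 = ℕₚ.m^n≢0 2 n
    Q≢0 = ℕₚ.m^n≢0 4 r
    A≢0 = (n ℕ.+ m) ℕₚ.!≢0
    E≢0 = (n ℕ.+ r) ℕₚ.!≢0
    H≢0 = N ℕₚ.!≢0
    cross : ∀ w A M F B I H R E P Q →
            w ℕ.* A ℕ.* (M ℕ.* F ℕ.* B) ℕ.* (I ℕ.* H ℕ.* (R ℕ.* E) ℕ.* (P ℕ.* Q))
            ≡ F ℕ.* H ℕ.* w ℕ.* (P ℕ.* (B ℕ.* M) ℕ.* (I ℕ.* A ℕ.* E ℕ.* R ℕ.* Q))
    cross = ℕ-solve-∀

term₁-closed : ∀ j i r → 2 ℕ.* (i ℕ.+ r) ≤ j →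
  term₁ j (i ℕ.+ r) r
    ≡ frac ((j ∸ i) C i) (2 ℕ.^ (j ∸ 2 ℕ.* i)) * ⟦ ((j ∸ 2 ℕ.* i) C r) ℕ.* foldWeight (j ∸ 2 ℕ.* i ∸ 2 ℕ.* r) ⟧
term₁-closed j i r h = subst (λ j → term₁ j (i ℕ.+ r) r ≡ diagonal₁ j) (ℕₚ.m+[n∸m]≡n h)
  (trans (term₁-factorials n i r) (trans (term₁-cross n i r) (sym (diagonal₁-factorials n i r))))
  where
  n = j ∸ 2 ℕ.* (i ℕ.+ r)
  diagonal₁ : ℕ → ℚ
  diagonal₁ j = frac ((j ∸ i) C i) (2 ℕ.^ (j ∸ 2 ℕ.* i)) * ⟦ ((j ∸ 2 ℕ.* i) C r) ℕ.* foldWeight (j ∸ 2 ℕ.* i ∸ 2 ℕ.* r) ⟧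

rhs1≡fib : ∀ j → rhs1 j ≡ ⟦ fib (suc j) ⟧
rhs1≡fib j = begin
  rhs1 j
    ≡⟨ sumTo-cong M (λ m _ → sumTo-*ˡ m (coefficient₁ j m) _) ⟩
  sumTo M (λ m → sumTo m (term₁ j m))
    ≡⟨ sumTo-by-difference M (term₁ j) ⟩
  sumTo M (λ i → sumTo (M ∸ i) (λ r → term₁ j (i ℕ.+ r) r))
    ≡⟨ sumTo-cong M (λ i i≤ → sumTo-cong (M ∸ i) (λ r r≤ → term₁-closed j i r (triangle-bound i≤ r≤))) ⟩
  sumTo M (λ i → sumTo (M ∸ i) (λ r → frac ((j ∸ i) C i) (2 ℕ.^ N i) * ⟦ (N i C r) ℕ.* foldWeight (N i ∸ 2 ℕ.* r) ⟧))
    ≡⟨ sumTo-collapse-inner M (λ i → frac ((j ∸ i) C i) (2 ℕ.^ N i)) (λ i r → (N i C r) ℕ.* foldWeight (N i ∸ 2 ℕ.* r)) ⟩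
  sumTo M (λ i → frac ((j ∸ i) C i) (2 ℕ.^ N i) * ⟦ sumToℕ (M ∸ i) (λ r → (N i C r) ℕ.* foldWeight (N i ∸ 2 ℕ.* r)) ⟧)
    ≡⟨ sumTo-cong M (λ i _ → cong (λ s → frac ((j ∸ i) C i) (2 ℕ.^ N i) * ⟦ s ⟧) (inner-sum i)) ⟩
  sumTo M (λ i → frac ((j ∸ i) C i) (2 ℕ.^ N i) * ⟦ 2 ℕ.^ N i ⟧)
    ≡⟨ sumTo-cong M (λ i _ → frac-*-denominator ((j ∸ i) C i) (2 ℕ.^ N i) {{ℕₚ.m^n≢0 2 (N i)}}) ⟩
  sumTo M (λ i → ⟦ (j ∸ i) C i ⟧)
    ≡⟨ ⟦fib⟧≡sumTo-binomials j ⟨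
  ⟦ fib (suc j) ⟧ ∎
  where
  open ≡-Reasoning
  M = ⌊ j /2⌋
  N : ℕ → ℕ
  N i = j ∸ 2 ℕ.* i
  inner-sum : ∀ i → sumToℕ (M ∸ i) (λ r → (N i C r) ℕ.* foldWeight (N i ∸ 2 ℕ.* r)) ≡ 2 ℕ.^ N i
  inner-sum i = trans (cong (λ b → sumToℕ b (λ r → (N i C r) ℕ.* foldWeight (N i ∸ 2 ℕ.* r)))
                            (sym (⌊[n∸2*i]/2⌋≡⌊n/2⌋∸i j i)))
                      (folded-binomial-sum (N i))

-- The second identity

coefficient₂ : ℕ → ℕ → ℚ
coefficient₂ j m = ⟦ j C m ⟧ * ((⟦ j ⟧ - ⟦ 2 ℕ.* m ⟧ + 1ℚ) ^ℚ 2 // (⟦ j ⟧ - ⟦ m ⟧ + 1ℚ))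

term₂ : ℕ → ℕ → ℕ → ℚ
term₂ j m k = coefficient₂ j m * hypTerm (- ⟦ m ⟧) (- ⟦ j ⟧ + ⟦ m ⟧ - 1ℚ) (- ⟦ j ⟧) (- ⟦ 4 ⟧) k

term₂-normal : ∀ n m k → term₂ (2 ℕ.* m ℕ.+ n) m k
  ≡ ⟦ (2 ℕ.* m ℕ.+ n) C m ⟧ * frac ((n ℕ.+ 1) ℕ.* (n ℕ.+ 1)) (suc (n ℕ.+ m))
    * hypTerm (- ⟦ m ⟧) (- ⟦ suc (n ℕ.+ m) ⟧) (- ⟦ 2 ℕ.* m ℕ.+ n ⟧) (- ⟦ 4 ⟧) k
term₂-normal n m k = cong₂ _*_ (cong (⟦ (2 ℕ.* m ℕ.+ n) C m ⟧ *_) square-over)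
                               (cong (λ b → hypTerm (- ⟦ m ⟧) b (- ⟦ 2 ℕ.* m ℕ.+ n ⟧) (- ⟦ 4 ⟧) k) b≡)
  where
  open ≡-Reasoning
  square-over : (⟦ 2 ℕ.* m ℕ.+ n ⟧ - ⟦ 2 ℕ.* m ⟧ + 1ℚ) ^ℚ 2 // (⟦ 2 ℕ.* m ℕ.+ n ⟧ - ⟦ m ⟧ + 1ℚ)
              ≡ frac ((n ℕ.+ 1) ℕ.* (n ℕ.+ 1)) (suc (n ℕ.+ m))
  square-over = begin
    (⟦ 2 ℕ.* m ℕ.+ n ⟧ - ⟦ 2 ℕ.* m ⟧ + 1ℚ) ^ℚ 2 // (⟦ 2 ℕ.* m ℕ.+ n ⟧ - ⟦ m ⟧ + 1ℚ)
      ≡⟨ cong₂ (λ a b → a ^ℚ 2 // b) (shifted-by-2m n m) (shifted-by-m n m) ⟩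
    (⟦ n ⟧ + 1ℚ) ^ℚ 2 // (⟦ n ℕ.+ m ⟧ + 1ℚ)
      ≡⟨ //-inv ((⟦ n ⟧ + 1ℚ) ^ℚ 2) (⟦ n ℕ.+ m ⟧ + 1ℚ) ⟩
    1ℚ * (⟦ n ⟧ + 1ℚ) * (⟦ n ⟧ + 1ℚ) * inv (⟦ n ℕ.+ m ⟧ + 1ℚ)
      ≡⟨ cong₂ (λ a b → a * inv b) square (sym (ℕtoℚ-suc (n ℕ.+ m))) ⟩
    frac ((n ℕ.+ 1) ℕ.* (n ℕ.+ 1)) (suc (n ℕ.+ m)) ∎
    where
    square : 1ℚ * (⟦ n ⟧ + 1ℚ) * (⟦ n ⟧ + 1ℚ) ≡ ⟦ (n ℕ.+ 1) ℕ.* (n ℕ.+ 1) ⟧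
    square = begin
      1ℚ * (⟦ n ⟧ + 1ℚ) * (⟦ n ⟧ + 1ℚ)   ≡⟨ cong (_* (⟦ n ⟧ + 1ℚ)) (ℚₚ.*-identityˡ (⟦ n ⟧ + 1ℚ)) ⟩
      (⟦ n ⟧ + 1ℚ) * (⟦ n ⟧ + 1ℚ)        ≡⟨ cong₂ _*_ (ℕtoℚ-homo-+ n 1) (ℕtoℚ-homo-+ n 1) ⟨
      ⟦ n ℕ.+ 1 ⟧ * ⟦ n ℕ.+ 1 ⟧          ≡⟨ ℕtoℚ-homo-* (n ℕ.+ 1) (n ℕ.+ 1) ⟨
      ⟦ (n ℕ.+ 1) ℕ.* (n ℕ.+ 1) ⟧        ∎
  b≡ : - ⟦ 2 ℕ.* m ℕ.+ n ⟧ + ⟦ m ⟧ - 1ℚ ≡ - ⟦ suc (n ℕ.+ m) ⟧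
  b≡ = begin
    - ⟦ 2 ℕ.* m ℕ.+ n ⟧ + ⟦ m ⟧ - 1ℚ     ≡⟨ negate (⟦ 2 ℕ.* m ℕ.+ n ⟧) ⟦ m ⟧ ⟩
    - (⟦ 2 ℕ.* m ℕ.+ n ⟧ - ⟦ m ⟧ + 1ℚ)   ≡⟨ cong -_ (trans (shifted-by-m n m) (sym (ℕtoℚ-suc (n ℕ.+ m)))) ⟩
    - ⟦ suc (n ℕ.+ m) ⟧                  ∎
    where
    negate : ∀ a b → - a + b - 1ℚ ≡ - (a - b + 1ℚ)
    negate = solve-∀ ℚ-ring

module _ (n k r : ℕ) where
  private
    m = k ℕ.+ r
    J = 2 ℕ.* (k ℕ.+ r) ℕ.+ n
    x = n ℕ.+ (k ℕ.+ r)
    N = r ℕ.+ (n ℕ.+ r)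
    S = (n ℕ.+ 1) ℕ.* (n ℕ.+ 1)
    Q = 4 ℕ.^ k
    F = (k ℕ.+ N) !
    G = (suc (n ℕ.+ r)) !
    J≡k+[k+N] : 2 ℕ.* (k ℕ.+ r) ℕ.+ n ≡ k ℕ.+ (k ℕ.+ (r ℕ.+ (n ℕ.+ r)))
    J≡k+[k+N] = ℕ-solve (k ∷ r ∷ n ∷ [])
    J≡2k+N : 2 ℕ.* (k ℕ.+ r) ℕ.+ n ≡ 2 ℕ.* k ℕ.+ (r ℕ.+ (n ℕ.+ r))
    J≡2k+N = ℕ-solve (k ∷ r ∷ n ∷ [])

  term₂-factorials : term₂ (2 ℕ.* (k ℕ.+ r) ℕ.+ n) (k ℕ.+ r) k
    ≡ frac (J ! ℕ.* S ℕ.* (m ! ℕ.* suc x ! ℕ.* F ℕ.* Q)) (m ! ℕ.* x ! ℕ.* suc x ℕ.* (r ! ℕ.* G ℕ.* J ! ℕ.* k !))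
  term₂-factorials = begin
    term₂ (2 ℕ.* (k ℕ.+ r) ℕ.+ n) (k ℕ.+ r) k
      ≡⟨ term₂-normal n m k ⟩
    ⟦ J C m ⟧ * frac S (suc x) * hypTerm (- ⟦ m ⟧) (- ⟦ suc x ⟧) (- ⟦ J ⟧) (- ⟦ 4 ⟧) k
      ≡⟨ cong₂ (λ c t → c * frac S (suc x) * t) (ℕtoℚ-C m x J≡m+x)
               (hypTerm₂-closed m (suc x) J k (m≡n+o⇒n≤m k r refl) (m≡n+o⇒n≤m k (suc (n ℕ.+ r)) 1+x≡k+[1+n+r])
                                (m≡n+o⇒n≤m k (k ℕ.+ N) J≡k+[k+N])) ⟩
    frac (J !) (m ! ℕ.* x !) * frac S (suc x)
      * frac (m ! ℕ.* suc x ! ℕ.* (J ∸ k) ! ℕ.* Q) ((m ∸ k) ! ℕ.* (suc x ∸ k) ! ℕ.* J ! ℕ.* k !)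
      ≡⟨ cong₂ (λ a b → frac (J !) (m ! ℕ.* x !) * frac S (suc x)
                          * frac (m ! ℕ.* suc x ! ℕ.* a ! ℕ.* Q) (b ! ℕ.* (suc x ∸ k) ! ℕ.* J ! ℕ.* k !))
               (m≡n+o⇒m∸n≡o k (k ℕ.+ N) J≡k+[k+N]) (ℕₚ.m+n∸m≡n k r) ⟩
    frac (J !) (m ! ℕ.* x !) * frac S (suc x) * frac (m ! ℕ.* suc x ! ℕ.* F ℕ.* Q) (r ! ℕ.* (suc x ∸ k) ! ℕ.* J ! ℕ.* k !)
      ≡⟨ cong (λ b → frac (J !) (m ! ℕ.* x !) * frac S (suc x)
                       * frac (m ! ℕ.* suc x ! ℕ.* F ℕ.* Q) (r ! ℕ.* b ! ℕ.* J ! ℕ.* k !))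
              (m≡n+o⇒m∸n≡o k (suc (n ℕ.+ r)) 1+x≡k+[1+n+r]) ⟩
    frac (J !) (m ! ℕ.* x !) * frac S (suc x) * frac (m ! ℕ.* suc x ! ℕ.* F ℕ.* Q) (r ! ℕ.* G ℕ.* J ! ℕ.* k !)
      ≡⟨ cong (_* frac (m ! ℕ.* suc x ! ℕ.* F ℕ.* Q) (r ! ℕ.* G ℕ.* J ! ℕ.* k !)) (frac-* (J !) (m ! ℕ.* x !) S (suc x)) ⟩
    frac (J ! ℕ.* S) (m ! ℕ.* x ! ℕ.* suc x) * frac (m ! ℕ.* suc x ! ℕ.* F ℕ.* Q) (r ! ℕ.* G ℕ.* J ! ℕ.* k !)
      ≡⟨ frac-* (J ! ℕ.* S) (m ! ℕ.* x ! ℕ.* suc x) (m ! ℕ.* suc x ! ℕ.* F ℕ.* Q) (r ! ℕ.* G ℕ.* J ! ℕ.* k !) ⟩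
    frac (J ! ℕ.* S ℕ.* (m ! ℕ.* suc x ! ℕ.* F ℕ.* Q)) (m ! ℕ.* x ! ℕ.* suc x ℕ.* (r ! ℕ.* G ℕ.* J ! ℕ.* k !)) ∎
    where
    open ≡-Reasoning
    J≡m+x : 2 ℕ.* (k ℕ.+ r) ℕ.+ n ≡ (k ℕ.+ r) ℕ.+ (n ℕ.+ (k ℕ.+ r))
    J≡m+x = ℕ-solve (k ∷ r ∷ n ∷ [])
    1+x≡k+[1+n+r] : suc (n ℕ.+ (k ℕ.+ r)) ≡ k ℕ.+ suc (n ℕ.+ r)
    1+x≡k+[1+n+r] = ℕ-solve (n ∷ k ∷ r ∷ [])

  diagonal₂-factorials :
    frac (((2 ℕ.* (k ℕ.+ r) ℕ.+ n ∸ k) C k) ℕ.* 4 ℕ.^ k) (suc (2 ℕ.* (k ℕ.+ r) ℕ.+ n ∸ 2 ℕ.* k))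
      * ⟦ (2 ℕ.* (k ℕ.+ r) ℕ.+ n ∸ 2 ℕ.* k ∸ 2 ℕ.* r ℕ.+ 1) ℕ.* (2 ℕ.* (k ℕ.+ r) ℕ.+ n ∸ 2 ℕ.* k ∸ 2 ℕ.* r ℕ.+ 1)
          ℕ.* (suc (2 ℕ.* (k ℕ.+ r) ℕ.+ n ∸ 2 ℕ.* k) C r) ⟧
    ≡ frac (F ℕ.* Q ℕ.* (S ℕ.* suc N !)) (k ! ℕ.* N ! ℕ.* suc N ℕ.* (1 ℕ.* (r ! ℕ.* G)))
  diagonal₂-factorials = begin
    frac (((J ∸ k) C k) ℕ.* Q) (suc (J ∸ 2 ℕ.* k))
      * ⟦ (J ∸ 2 ℕ.* k ∸ 2 ℕ.* r ℕ.+ 1) ℕ.* (J ∸ 2 ℕ.* k ∸ 2 ℕ.* r ℕ.+ 1) ℕ.* (suc (J ∸ 2 ℕ.* k) C r) ⟧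
      ≡⟨ cong₂ (λ a b → frac ((a C k) ℕ.* Q) (suc b) * ⟦ (b ∸ 2 ℕ.* r ℕ.+ 1) ℕ.* (b ∸ 2 ℕ.* r ℕ.+ 1) ℕ.* (suc b C r) ⟧)
               (m≡n+o⇒m∸n≡o k (k ℕ.+ N) J≡k+[k+N]) (m≡n+o⇒m∸n≡o (2 ℕ.* k) N J≡2k+N) ⟩
    frac (((k ℕ.+ N) C k) ℕ.* Q) (suc N) * ⟦ (N ∸ 2 ℕ.* r ℕ.+ 1) ℕ.* (N ∸ 2 ℕ.* r ℕ.+ 1) ℕ.* (suc N C r) ⟧
      ≡⟨ cong (λ e → frac (((k ℕ.+ N) C k) ℕ.* Q) (suc N) * ⟦ (e ℕ.+ 1) ℕ.* (e ℕ.+ 1) ℕ.* (suc N C r) ⟧)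
              (m≡n+o⇒m∸n≡o (2 ℕ.* r) n N≡2r+n) ⟩
    frac (((k ℕ.+ N) C k) ℕ.* Q) (suc N) * ⟦ S ℕ.* (suc N C r) ⟧
      ≡⟨ cong₂ (λ a b → a * inv ⟦ suc N ⟧ * b) (ℕtoℚ-homo-* ((k ℕ.+ N) C k) Q) (ℕtoℚ-homo-* S (suc N C r)) ⟩
    ⟦ (k ℕ.+ N) C k ⟧ * ⟦ Q ⟧ * inv ⟦ suc N ⟧ * (⟦ S ⟧ * ⟦ suc N C r ⟧)
      ≡⟨ cong₂ (λ a b → a * ⟦ Q ⟧ * inv ⟦ suc N ⟧ * (⟦ S ⟧ * b))
               (ℕtoℚ-C k N refl) (ℕtoℚ-C r (suc (n ℕ.+ r)) 1+N≡r+[1+n+r]) ⟩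
    frac F (k ! ℕ.* N !) * ⟦ Q ⟧ * inv ⟦ suc N ⟧ * (⟦ S ⟧ * frac (suc N !) (r ! ℕ.* G))
      ≡⟨ cong₂ (λ a b → a * (b * frac (suc N !) (r ! ℕ.* G)))
               (sym (ℚₚ.*-assoc (frac F (k ! ℕ.* N !)) ⟦ Q ⟧ (inv ⟦ suc N ⟧))) (frac-1 S) ⟨
    frac F (k ! ℕ.* N !) * frac Q (suc N) * (frac S 1 * frac (suc N !) (r ! ℕ.* G))
      ≡⟨ cong₂ _*_ (frac-* F (k ! ℕ.* N !) Q (suc N)) (frac-* S 1 (suc N !) (r ! ℕ.* G)) ⟩
    frac (F ℕ.* Q) (k ! ℕ.* N ! ℕ.* suc N) * frac (S ℕ.* suc N !) (1 ℕ.* (r ! ℕ.* G))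
      ≡⟨ frac-* (F ℕ.* Q) (k ! ℕ.* N ! ℕ.* suc N) (S ℕ.* suc N !) (1 ℕ.* (r ! ℕ.* G)) ⟩
    frac (F ℕ.* Q ℕ.* (S ℕ.* suc N !)) (k ! ℕ.* N ! ℕ.* suc N ℕ.* (1 ℕ.* (r ! ℕ.* G))) ∎
    where
    open ≡-Reasoning
    N≡2r+n : r ℕ.+ (n ℕ.+ r) ≡ 2 ℕ.* r ℕ.+ n
    N≡2r+n = ℕ-solve (r ∷ n ∷ [])
    1+N≡r+[1+n+r] : suc (r ℕ.+ (n ℕ.+ r)) ≡ r ℕ.+ suc (n ℕ.+ r)
    1+N≡r+[1+n+r] = ℕ-solve (r ∷ n ∷ [])

  term₂-cross : frac (J ! ℕ.* S ℕ.* (m ! ℕ.* suc x ! ℕ.* F ℕ.* Q)) (m ! ℕ.* x ! ℕ.* suc x ℕ.* (r ! ℕ.* G ℕ.* J ! ℕ.* k !))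
              ≡ frac (F ℕ.* Q ℕ.* (S ℕ.* suc N !)) (k ! ℕ.* N ! ℕ.* suc N ℕ.* (1 ℕ.* (r ! ℕ.* G)))
  term₂-cross = frac-cross (J ! ℕ.* S ℕ.* (m ! ℕ.* suc x ! ℕ.* F ℕ.* Q))
                           (m ! ℕ.* x ! ℕ.* suc x ℕ.* (r ! ℕ.* G ℕ.* J ! ℕ.* k !))
                           (F ℕ.* Q ℕ.* (S ℕ.* suc N !)) (k ! ℕ.* N ! ℕ.* suc N ℕ.* (1 ℕ.* (r ! ℕ.* G)))
                           {{m ℕₚ.!≢0 ⊛ x ℕₚ.!≢0 ⊛ ℕ.nonZero {x} ⊛ (r ℕₚ.!≢0 ⊛ G≢0 ⊛ J ℕₚ.!≢0 ⊛ k ℕₚ.!≢0)}}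
                           {{k ℕₚ.!≢0 ⊛ N ℕₚ.!≢0 ⊛ ℕ.nonZero {N} ⊛ (ℕ.nonZero {0} ⊛ (r ℕₚ.!≢0 ⊛ G≢0))}}
                           (cross (J !) S (m !) (suc x) (x !) F Q (k !) (N !) (suc N) (r !) G)
    where
    G≢0 = suc (n ℕ.+ r) ℕₚ.!≢0
    cross : ∀ J S M y X F Q K Nf s R G →
            J ℕ.* S ℕ.* (M ℕ.* (y ℕ.* X) ℕ.* F ℕ.* Q) ℕ.* (K ℕ.* Nf ℕ.* s ℕ.* (1 ℕ.* (R ℕ.* G)))
            ≡ F ℕ.* Q ℕ.* (S ℕ.* (s ℕ.* Nf)) ℕ.* (M ℕ.* X ℕ.* y ℕ.* (R ℕ.* G ℕ.* J ℕ.* K))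
    cross = ℕ-solve-∀

term₂-closed : ∀ j k r → 2 ℕ.* (k ℕ.+ r) ≤ j →
  term₂ j (k ℕ.+ r) k
    ≡ frac (((j ∸ k) C k) ℕ.* 4 ℕ.^ k) (suc (j ∸ 2 ℕ.* k))
      * ⟦ (j ∸ 2 ℕ.* k ∸ 2 ℕ.* r ℕ.+ 1) ℕ.* (j ∸ 2 ℕ.* k ∸ 2 ℕ.* r ℕ.+ 1) ℕ.* (suc (j ∸ 2 ℕ.* k) C r) ⟧
term₂-closed j k r h = subst (λ j → term₂ j (k ℕ.+ r) k ≡ diagonal₂ j) (ℕₚ.m+[n∸m]≡n h)
  (trans (term₂-factorials n k r) (trans (term₂-cross n k r) (sym (diagonal₂-factorials n k r))))
  where
  n = j ∸ 2 ℕ.* (k ℕ.+ r)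
  diagonal₂ : ℕ → ℚ
  diagonal₂ j = frac (((j ∸ k) C k) ℕ.* 4 ℕ.^ k) (suc (j ∸ 2 ℕ.* k))
      * ⟦ (j ∸ 2 ℕ.* k ∸ 2 ℕ.* r ℕ.+ 1) ℕ.* (j ∸ 2 ℕ.* k ∸ 2 ℕ.* r ℕ.+ 1) ℕ.* (suc (j ∸ 2 ℕ.* k) C r) ⟧

rhs2≡fib : ∀ j → rhs2 j ≡ ⟦ fib (suc j) ⟧
rhs2≡fib j = begin
  rhs2 j
    ≡⟨ cong (scale *_) (sumTo-cong M (λ m _ → sumTo-*ˡ m (coefficient₂ j m) _)) ⟩
  scale * sumTo M (λ m → sumTo m (term₂ j m))
    ≡⟨ cong (scale *_) (sumTo-exchange M (term₂ j)) ⟩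
  scale * sumTo M (λ k → sumTo (M ∸ k) (λ r → term₂ j (k ℕ.+ r) k))
    ≡⟨ cong (scale *_) (sumTo-cong M (λ k k≤ → sumTo-cong (M ∸ k) (λ r r≤ → term₂-closed j k r (triangle-bound k≤ r≤)))) ⟩
  scale * sumTo M (λ k → sumTo (M ∸ k) (λ r → frac (((j ∸ k) C k) ℕ.* 4 ℕ.^ k) (suc (N k)) * ⟦ g k r ⟧))
    ≡⟨ cong (scale *_) (sumTo-collapse-inner M (λ k → frac (((j ∸ k) C k) ℕ.* 4 ℕ.^ k) (suc (N k))) g) ⟩
  scale * sumTo M (λ k → frac (((j ∸ k) C k) ℕ.* 4 ℕ.^ k) (suc (N k)) * ⟦ sumToℕ (M ∸ k) (g k) ⟧)
    ≡⟨ cong (scale *_) (sumTo-cong M (λ k k≤ → collapse-row k (≤⌊n/2⌋⇒2*≤n k≤))) ⟩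
  scale * sumTo M (λ k → ⟦ ((j ∸ k) C k) ℕ.* 2 ℕ.^ j ⟧)
    ≡⟨ sumTo-*ˡ M scale (λ k → ⟦ ((j ∸ k) C k) ℕ.* 2 ℕ.^ j ⟧) ⟩
  sumTo M (λ k → scale * ⟦ ((j ∸ k) C k) ℕ.* 2 ℕ.^ j ⟧)
    ≡⟨ sumTo-cong M (λ k _ → unscale ((j ∸ k) C k)) ⟩
  sumTo M (λ k → ⟦ (j ∸ k) C k ⟧)
    ≡⟨ ⟦fib⟧≡sumTo-binomials j ⟨
  ⟦ fib (suc j) ⟧ ∎
  where
  open ≡-Reasoning
  M = ⌊ j /2⌋
  scale = inv (⟦ 2 ⟧ ^ℚ j)
  N : ℕ → ℕ
  N k = j ∸ 2 ℕ.* k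
  g : ℕ → ℕ → ℕ
  g k r = (N k ∸ 2 ℕ.* r ℕ.+ 1) ℕ.* (N k ∸ 2 ℕ.* r ℕ.+ 1) ℕ.* (suc (N k) C r)
  collapse-row : ∀ k → 2 ℕ.* k ≤ j →
    frac (((j ∸ k) C k) ℕ.* 4 ℕ.^ k) (suc (N k)) * ⟦ sumToℕ (M ∸ k) (g k) ⟧ ≡ ⟦ ((j ∸ k) C k) ℕ.* 2 ℕ.^ j ⟧
  collapse-row k 2k≤j = begin
    frac (((j ∸ k) C k) ℕ.* 4 ℕ.^ k) (suc (N k)) * ⟦ sumToℕ (M ∸ k) (g k) ⟧
      ≡⟨ cong (λ b → frac (((j ∸ k) C k) ℕ.* 4 ℕ.^ k) (suc (N k)) * ⟦ sumToℕ b (g k) ⟧)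
              (sym (⌊[n∸2*i]/2⌋≡⌊n/2⌋∸i j k)) ⟩
    frac (((j ∸ k) C k) ℕ.* 4 ℕ.^ k) (suc (N k)) * ⟦ sumToℕ ⌊ N k /2⌋ (g k) ⟧
      ≡⟨ cong (λ s → frac (((j ∸ k) C k) ℕ.* 4 ℕ.^ k) (suc (N k)) * ⟦ s ⟧) (weighted-binomial-sum (N k)) ⟩
    frac (((j ∸ k) C k) ℕ.* 4 ℕ.^ k) (suc (N k)) * ⟦ suc (N k) ℕ.* 2 ℕ.^ N k ⟧
      ≡⟨ frac-*-multiple (((j ∸ k) C k) ℕ.* 4 ℕ.^ k) (suc (N k)) (2 ℕ.^ N k) ⟩
    ⟦ ((j ∸ k) C k) ℕ.* 4 ℕ.^ k ℕ.* 2 ℕ.^ N k ⟧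
      ≡⟨ cong ⟦_⟧ (trans (ℕₚ.*-assoc ((j ∸ k) C k) (4 ℕ.^ k) (2 ℕ.^ N k)) (cong (((j ∸ k) C k) ℕ.*_) powers)) ⟩
    ⟦ ((j ∸ k) C k) ℕ.* 2 ℕ.^ j ⟧ ∎
    where
    powers : 4 ℕ.^ k ℕ.* 2 ℕ.^ N k ≡ 2 ℕ.^ j
    powers = begin
      4 ℕ.^ k ℕ.* 2 ℕ.^ N k          ≡⟨ ℕₚ.*-comm (4 ℕ.^ k) (2 ℕ.^ N k) ⟩
      2 ℕ.^ N k ℕ.* 4 ℕ.^ k          ≡⟨ 2^[n+2r]≡2^n*4^r (N k) k ⟨
      2 ℕ.^ (N k ℕ.+ 2 ℕ.* k)        ≡⟨ cong (2 ℕ.^_) (ℕₚ.m∸n+n≡m 2k≤j) ⟩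
      2 ℕ.^ j                        ∎
  unscale : ∀ c → scale * ⟦ c ℕ.* 2 ℕ.^ j ⟧ ≡ ⟦ c ⟧
  unscale c = begin
    inv (⟦ 2 ⟧ ^ℚ j) * ⟦ c ℕ.* 2 ℕ.^ j ⟧     ≡⟨ cong (λ x → inv x * ⟦ c ℕ.* 2 ℕ.^ j ⟧) (ℕtoℚ-homo-^ 2 j) ⟩
    inv ⟦ 2 ℕ.^ j ⟧ * ⟦ c ℕ.* 2 ℕ.^ j ⟧      ≡⟨ ℚₚ.*-comm (inv ⟦ 2 ℕ.^ j ⟧) ⟦ c ℕ.* 2 ℕ.^ j ⟧ ⟩
    frac (c ℕ.* 2 ℕ.^ j) (2 ℕ.^ j)          ≡⟨ frac-cancel c (2 ℕ.^ j) {{ℕₚ.m^n≢0 2 j}} ⟩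
    ⟦ c ⟧                                    ∎

corollary2 : (j : ℕ) → (ℕtoℚ (fib (suc j)) ≡ rhs1 j) × (ℕtoℚ (fib (suc j)) ≡ rhs2 j)
corollary2 j = sym (rhs1≡fib j) , sym (rhs2≡fib j)
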